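{- Let $n\ge5$ and $s$ be integers with $1<s<n/2$, let $q=\lfloor n/s\rfloor$ and $r=n-qs$. If $r\le q$ or $r+q\ge s+1$, then $$\pi(C_n(1,s))\ge \frac12\left\lfloor\frac{(s+1)^2}{2}\right\rfloor.$$
   Context: The circulant graph $C_n(1,s)$ has vertex set $\mathbb{Z}_n$, with $i,j$ adjacent iff $i-j\in\{\pm1,\pm s\}$ mod $n$. An all-to-all routing $R$ of a graph $G$ is a set of oriented paths with exactly one path from $x$ to $y$ for each ordered pair of distinct vertices $(x,y)$. The load of an edge under $R$ is the number of paths of $R$ using it (in either direction); $\pi(G,R)$ is the maximum edge load and the edge-forwarding index is $\pi(G)=\min_R\pi(G,R)$ over all all-to-all routings $R$. -}

module Defs where

open import Data.Nat using (ℕ; zero; suc; _+_; _*_; _∸_; _≤ᵇ_; _≡ᵇ_; _⊔_)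
open import Data.Bool using (Bool; true; false; _∨_; _∧_; not; if_then_else_; T)
open import Data.Fin using (Fin; toℕ; _≟_)
open import Data.List using (List; []; _∷_; head; last; allFin; concatMap; foldr; map)
open import Data.Nat.ListAction using (sum)
open import Data.List.Relation.Unary.Linked using (Linked)
open import Data.List.Relation.Unary.Unique.Propositional using (Unique)
open import Data.Maybe using (just)
open import Data.Product using (_×_)
open import Relation.Nullary using (does; ¬_)
open import Relation.Binary.PropositionalEquality using (_≡_)

diff : (n : ℕ) → Fin n → Fin n → ℕ
diff n u v = if toℕ v ≤ᵇ toℕ u then toℕ u ∸ toℕ v else (toℕ u + n) ∸ toℕ v

-- adjacency in the circulant graph C_n(1,s): u - v ∈ {±1, ±s} mod n
adj : (n s : ℕ) → Fin n → Fin n → Bool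
adj n s u v = let d = diff n u v in
  (d ≡ᵇ 1) ∨ (d ≡ᵇ (n ∸ 1)) ∨ (d ≡ᵇ s) ∨ (d ≡ᵇ (n ∸ s))

Adj : (n s : ℕ) → Fin n → Fin n → Set
Adj n s u v = T (adj n s u v)

IsPath : (n s : ℕ) → List (Fin n) → Fin n → Fin n → Set
IsPath n s p x y =
  (head p ≡ just x) × (last p ≡ just y) × Linked (Adj n s) p × Unique p

-- a routing assigns a vertex list to each ordered pair (the value on the
-- diagonal x = y is irrelevant); it is an all-to-all routing if R x y is a
-- path from x to y for every ordered pair of distinct vertices
Routing : ℕ → Set
Routing n = Fin n → Fin n → List (Fin n)

IsAllToAllRouting : (n s : ℕ) → Routing n → Set
IsAllToAllRouting n s R = ∀ (x y : Fin n) → ¬ (x ≡ y) → IsPath n s (R x y) x y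

eqF : {n : ℕ} → Fin n → Fin n → Bool
eqF a b = does (a ≟ b)

uses : {n : ℕ} → List (Fin n) → Fin n → Fin n → Bool
uses [] u v = false
uses (a ∷ []) u v = false
uses (a ∷ b ∷ p) u v =
  ((eqF a u ∧ eqF b v) ∨ (eqF a v ∧ eqF b u)) ∨ uses (b ∷ p) u v

load : (n : ℕ) → Routing n → Fin n → Fin n → ℕ
load n R u v = sum (concatMap (λ x → map (λ y →
  if not (eqF x y) ∧ uses (R x y) u v then 1 else 0) (allFin n)) (allFin n))

maxLoad : (n s : ℕ) → Routing n → ℕ
maxLoad n s R = foldr _⊔_ 0 (concatMap (λ u → map (λ v →
  if adj n s u v then load n R u v else 0) (allFin n)) (allFin n))

-- Write ‖z‖ = min(z mod n, n − z mod n) for the distance from z to 0 in ℤ_n, and let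
--   Φ(z) = min(s, min_{0 ≤ b < s} (b + ‖z ± b s‖)).
-- Φ(0) = 0 and Φ changes by at most 1 along an edge of C_n(1,s), so Φ(y − x) is at most the
-- length of every path from x to y.  A simple path with k edges contributes 2k to the sum of the
-- loads over ordered adjacent pairs (u,v), and every vertex has at most 4 neighbours; hence
-- 2 n Σ_z Φ(z) ≤ 4 n π, i.e. Σ_z Φ(z) ≤ 2π.
-- The hypothesis r ≤ q or r + q ≥ s + 1 is used only to show that for 0 ≤ b ≤ s the multiple b s is
-- either within b of 0 in ℤ_n or at distance at least s + 1 − b from it.  With the triangle
-- inequality for ‖·‖ this gives Φ(v) = Φ(−v) ≥ min(v, s + 1 − v) for 1 ≤ v ≤ s, so that
-- Σ_z Φ(z) ≥ 2 Σ_{v=1}^{s} min(v, s + 1 − v) ≥ ⌊(s+1)²/2⌋.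

module Submission where

open import Defs
open import Data.Bool using (Bool; true; false; T; not; _∧_; _∨_; if_then_else_)
open import Data.Bool.Properties using (T-∨; T-∧)
open import Data.Empty using (⊥; ⊥-elim)
open import Data.Fin as Fin using (Fin; toℕ)
import Data.Fin.Properties as Fin
open import Data.Fin.Properties using (toℕ<n; toℕ-injective)
open import Data.List using (List; []; _∷_; map; concatMap; allFin; foldr; tabulate; length; last)
open import Data.List.Membership.Propositional using (_∈_; _∉_)
open import Data.List.Membership.Propositional.Properties using (∈-allFin; ∈-map⁺; ∈-concatMap⁺)
open import Data.List.Properties using (map-tabulate)
open import Data.List.Relation.Unary.All using (_∷_)
open import Data.List.Relation.Unary.All.Properties using (All¬⇒¬Any)
open import Data.List.Relation.Unary.AllPairs using (_∷_)
open import Data.List.Relation.Unary.Any using (here; there) renaming (map to any-map)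
open import Data.List.Relation.Unary.Linked using (Linked; _∷_; [-])
open import Data.List.Relation.Unary.Unique.Propositional using (Unique)
open import Data.Maybe using (just)
open import Data.Nat
  using (ℕ; zero; suc; _+_; _*_; _∸_; _≤_; _<_; _⊓_; _⊔_; _%_; _/_; _≤ᵇ_; _≡ᵇ_; z≤n; s≤s; NonZero; >-nonZero; >-nonZero⁻¹)
open import Data.Nat.DivMod
import Data.Nat.ListAction as ListAction
open import Data.Nat.ListAction.Properties using (sum-++)
open import Data.Nat.Properties
open import Data.Nat.Tactic.RingSolver using (solve-∀)
open import Data.Product using (_×_; _,_; proj₁; proj₂; ∃) renaming (map to ×-map)
open import Data.Sum using (_⊎_; inj₁; inj₂; [_,_]′) renaming (map to ⊎-map)
open import Function using (_∘_; id; Equivalence)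
open import Relation.Binary.PropositionalEquality
open import Relation.Nullary using (Dec; yes; no; ¬_)
open import Algebra.Properties.Monoid.Sum +-0-monoid using (sum-syntax; sum-cong-≗)

open Equivalence using (to; from)

∑-mono-≤ : ∀ n {f g : Fin n → ℕ} → (∀ i → f i ≤ g i) → ∑[ i < n ] f i ≤ ∑[ i < n ] g i
∑-mono-≤ zero    f≤g = z≤n
∑-mono-≤ (suc n) f≤g = +-mono-≤ (f≤g Fin.zero) (∑-mono-≤ n (f≤g ∘ Fin.suc))

∑-distrib-+ : ∀ n (f g : Fin n → ℕ) → ∑[ i < n ] (f i + g i) ≡ ∑[ i < n ] f i + ∑[ i < n ] g i
∑-distrib-+ zero    f g = refl
∑-distrib-+ (suc n) f g = begin
  f₀ + g₀ + ∑[ i < n ] (f (Fin.suc i) + g (Fin.suc i))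
    ≡⟨ cong (f₀ + g₀ +_) (∑-distrib-+ n (f ∘ Fin.suc) (g ∘ Fin.suc)) ⟩
  f₀ + g₀ + (∑[ i < n ] f (Fin.suc i) + ∑[ i < n ] g (Fin.suc i))
    ≡⟨ +-interchange f₀ g₀ _ _ ⟩
  f₀ + ∑[ i < n ] f (Fin.suc i) + (g₀ + ∑[ i < n ] g (Fin.suc i)) ∎
  where
  open ≡-Reasoning
  f₀ = f Fin.zero
  g₀ = g Fin.zero
  +-interchange : ∀ a b c d → a + b + (c + d) ≡ a + c + (b + d)
  +-interchange = solve-∀

∑-const : ∀ n c → ∑[ i < n ] c ≡ n * c
∑-const zero    c = refl
∑-const (suc n) c = cong (c +_) (∑-const n c)

∑-zero : ∀ n {f : Fin n → ℕ} → (∀ i → f i ≡ 0) → ∑[ i < n ] f i ≡ 0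
∑-zero n f≡0 = trans (sum-cong-≗ f≡0) (trans (∑-const n 0) (*-zeroʳ n))

∑-swap : ∀ m n (f : Fin m → Fin n → ℕ) →
  ∑[ i < m ] ∑[ j < n ] f i j ≡ ∑[ j < n ] ∑[ i < m ] f i j
∑-swap zero    n f = sym (∑-zero n (λ _ → refl))
∑-swap (suc m) n f = trans (cong (∑[ j < n ] f Fin.zero j +_) (∑-swap m n (f ∘ Fin.suc)))
  (sym (∑-distrib-+ n (f Fin.zero) (λ j → ∑[ i < m ] f (Fin.suc i) j)))

∑-distribˡ-* : ∀ n c (f : Fin n → ℕ) → ∑[ i < n ] (c * f i) ≡ c * ∑[ i < n ] f i
∑-distribˡ-* zero    c f = sym (*-zeroʳ c)
∑-distribˡ-* (suc n) c f = trans (cong (c * f Fin.zero +_) (∑-distribˡ-* n c (f ∘ Fin.suc)))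
  (sym (*-distribˡ-+ c (f Fin.zero) _))

∑∑-swap : ∀ m n (f : Fin m → Fin m → Fin n → Fin n → ℕ) →
  ∑[ i < m ] ∑[ j < m ] ∑[ k < n ] ∑[ l < n ] f i j k l ≡ ∑[ k < n ] ∑[ l < n ] ∑[ i < m ] ∑[ j < m ] f i j k l
∑∑-swap m n f = begin
  ∑[ i < m ] ∑[ j < m ] ∑[ k < n ] ∑[ l < n ] f i j k l   ≡⟨ sum-cong-≗ (λ i → ∑-swap m n (λ j k → ∑[ l < n ] f i j k l)) ⟩
  ∑[ i < m ] ∑[ k < n ] ∑[ j < m ] ∑[ l < n ] f i j k l   ≡⟨ ∑-swap m n (λ i k → ∑[ j < m ] ∑[ l < n ] f i j k l) ⟩
  ∑[ k < n ] ∑[ i < m ] ∑[ j < m ] ∑[ l < n ] f i j k l   ≡⟨ sum-cong-≗ (λ k → sum-cong-≗ (λ i → ∑-swap m n (λ j l → f i j k l))) ⟩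
  ∑[ k < n ] ∑[ i < m ] ∑[ l < n ] ∑[ j < m ] f i j k l   ≡⟨ sum-cong-≗ (λ k → ∑-swap m n (λ i l → ∑[ j < m ] f i j k l)) ⟩
  ∑[ k < n ] ∑[ l < n ] ∑[ i < m ] ∑[ j < m ] f i j k l   ∎
  where open ≡-Reasoning

indicator : Bool → ℕ
indicator b = if b then 1 else 0

indicator-∧ : ∀ x y → indicator (x ∧ y) ≡ indicator x * indicator y
indicator-∧ true  y = sym (+-identityʳ _)
indicator-∧ false y = refl

indicator-∨ : ∀ x y → (T x → T y → ⊥) → indicator (x ∨ y) ≡ indicator x + indicator y
indicator-∨ true  true  disjoint = ⊥-elim (disjoint _ _)
indicator-∨ true  false disjoint = refl
indicator-∨ false y     disjoint = refl

indicator-∨-≤ : ∀ x y → indicator (x ∨ y) ≤ indicator x + indicator y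
indicator-∨-≤ true  y = s≤s z≤n
indicator-∨-≤ false y = ≤-refl

∑-indicator-≤1 : ∀ n (P : Fin n → Bool) → (∀ i j → T (P i) → T (P j) → i ≡ j) →
  ∑[ i < n ] indicator (P i) ≤ 1
∑-indicator-≤1 zero    P unique = z≤n
∑-indicator-≤1 (suc n) P unique with P Fin.zero in P₀
... | true  = ≤-reflexive (cong suc (∑-zero n rest))
  where
  rest : ∀ i → indicator (P (Fin.suc i)) ≡ 0
  rest i with P (Fin.suc i) in Pᵢ
  ... | true  with () ← unique Fin.zero (Fin.suc i) (subst T (sym P₀) _) (subst T (sym Pᵢ) _)
  ... | false = refl
... | false = ∑-indicator-≤1 n (P ∘ Fin.suc) (λ i j Pi Pj → Fin.suc-injective (unique _ _ Pi Pj))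

∑ℕ : ℕ → (ℕ → ℕ) → ℕ
∑ℕ zero    f = 0
∑ℕ (suc n) f = f 0 + ∑ℕ n (f ∘ suc)

syntax ∑ℕ n (λ i → x) = ∑ℕ[ i < n ] x

∑-toℕ : ∀ n (f : ℕ → ℕ) → ∑[ i < n ] f (toℕ i) ≡ ∑ℕ[ i < n ] f i
∑-toℕ zero    f = refl
∑-toℕ (suc n) f = cong (f 0 +_) (∑-toℕ n (f ∘ suc))

∑ℕ-cong : ∀ n {f g : ℕ → ℕ} → (∀ i → i < n → f i ≡ g i) → ∑ℕ[ i < n ] f i ≡ ∑ℕ[ i < n ] g i
∑ℕ-cong zero    f≡g = refl
∑ℕ-cong (suc n) f≡g = cong₂ _+_ (f≡g 0 (s≤s z≤n)) (∑ℕ-cong n (λ i i<n → f≡g (suc i) (s≤s i<n)))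

∑ℕ-mono-≤ : ∀ n {f g : ℕ → ℕ} → (∀ i → i < n → f i ≤ g i) → ∑ℕ[ i < n ] f i ≤ ∑ℕ[ i < n ] g i
∑ℕ-mono-≤ zero    f≤g = z≤n
∑ℕ-mono-≤ (suc n) f≤g = +-mono-≤ (f≤g 0 (s≤s z≤n)) (∑ℕ-mono-≤ n (λ i i<n → f≤g (suc i) (s≤s i<n)))

∑ℕ-+ : ∀ m n (f : ℕ → ℕ) → ∑ℕ[ i < m + n ] f i ≡ ∑ℕ[ i < m ] f i + ∑ℕ[ i < n ] f (m + i)
∑ℕ-+ zero    n f = refl
∑ℕ-+ (suc m) n f = trans (cong (f 0 +_) (∑ℕ-+ m n (f ∘ suc))) (sym (+-assoc (f 0) _ _))

∑ℕ-init-last : ∀ n (f : ℕ → ℕ) → ∑ℕ[ i < suc n ] f i ≡ ∑ℕ[ i < n ] f i + f n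
∑ℕ-init-last n f = trans (cong (λ m → ∑ℕ[ i < m ] f i) (+-comm 1 n))
  (trans (∑ℕ-+ n 1 f) (cong (∑ℕ[ i < n ] f i +_) (trans (+-identityʳ _) (cong f (+-identityʳ n)))))

∑ℕ-periodic-shift : ∀ n (f : ℕ → ℕ) → (∀ z → f (z + n) ≡ f z) →
  ∀ c → ∑ℕ[ i < n ] f (i + c) ≡ ∑ℕ[ i < n ] f i
∑ℕ-periodic-shift n f periodic zero    = ∑ℕ-cong n (λ i _ → cong f (+-identityʳ i))
∑ℕ-periodic-shift n f periodic (suc c) = trans shift (∑ℕ-periodic-shift n f periodic c)
  where
  open ≡-Reasoning
  shift : ∑ℕ[ i < n ] f (i + suc c) ≡ ∑ℕ[ i < n ] f (i + c)
  shift = +-cancelʳ-≡ (f c) _ _ (begin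
    ∑ℕ[ i < n ] f (i + suc c) + f c       ≡⟨ +-comm _ (f c) ⟩
    f c + ∑ℕ[ i < n ] f (i + suc c)       ≡⟨ cong (f c +_) (∑ℕ-cong n (λ i _ → cong f (+-suc i c))) ⟩
    ∑ℕ[ i < suc n ] f (i + c)             ≡⟨ ∑ℕ-init-last n (λ i → f (i + c)) ⟩
    ∑ℕ[ i < n ] f (i + c) + f (n + c)     ≡⟨ cong (∑ℕ[ i < n ] f (i + c) +_) (trans (cong f (+-comm n c)) (periodic c)) ⟩
    ∑ℕ[ i < n ] f (i + c) + f c           ∎)

-- The circular norm on ℤ_n

module CircularNorm (n : ℕ) .{{_ : NonZero n}} where

  ‖_‖ : ℕ → ℕ
  ‖ z ‖ = z % n ⊓ (n ∸ z % n)

  %-≡-+* : ∀ z t i j → z + i * n ≡ t + j * n → z % n ≡ t % n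
  %-≡-+* z t i j eq = trans (sym ([m+kn]%n≡m%n z i n)) (trans (cong (_% n) eq) ([m+kn]%n≡m%n t j n))

  ‖‖-residue : ∀ {z t} → z % n ≡ t → ‖ z ‖ ≡ t ⊓ (n ∸ t)
  ‖‖-residue = cong (λ a → a ⊓ (n ∸ a))

  ‖‖-cong : ∀ {z t} → z % n ≡ t % n → ‖ z ‖ ≡ ‖ t ‖
  ‖‖-cong = ‖‖-residue

  ‖‖-+n : ∀ z → ‖ z + n ‖ ≡ ‖ z ‖
  ‖‖-+n z = ‖‖-cong ([m+n]%n≡m%n z n)

  ‖‖≤% : ∀ z → ‖ z ‖ ≤ z % n
  ‖‖≤% z = m⊓n≤m _ _

  ‖‖-lower : ∀ {t τ} → t < n → τ ≤ t → τ + t ≤ n → τ ≤ ‖ t ‖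
  ‖‖-lower {t} t<n τ≤t τ+t≤n = subst (_ ≤_) (sym (‖‖-residue (m<n⇒m%n≡m t<n))) (⊓-glb τ≤t (m+n≤o⇒m≤o∸n _ τ+t≤n))

  [m+c]%n≡[m%n+c]%n : ∀ z c → (z + c) % n ≡ (z % n + c) % n
  [m+c]%n≡[m%n+c]%n z c = %-≡-+* (z + c) (z % n + c) 0 (z / n) (begin
    z + c + 0                  ≡⟨ +-identityʳ _ ⟩
    z + c                      ≡⟨ cong (_+ c) (m≡m%n+[m/n]*n z n) ⟩
    z % n + z / n * n + c      ≡⟨ +-swap-last (z % n) (z / n * n) c ⟩
    z % n + c + z / n * n      ∎)
    where
    open ≡-Reasoning
    +-swap-last : ∀ a b c → a + b + c ≡ a + c + b
    +-swap-last = solve-∀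

  ‖‖-suc : ∀ z → ‖ z + 1 ‖ ≤ suc ‖ z ‖
  ‖‖-suc z with z % n in z%n≡a | m%n<n z n
  ... | a | a<n = go (suc a <? n)
    where
    [z+1]%n≡[1+a]%n : (z + 1) % n ≡ suc a % n
    [z+1]%n≡[1+a]%n = trans ([m+c]%n≡[m%n+c]%n z 1) (trans (cong (λ x → (x + 1) % n) z%n≡a) (cong (_% n) (+-comm a 1)))
    go : Dec (suc a < n) → ‖ z + 1 ‖ ≤ suc (a ⊓ (n ∸ a))
    go (yes 1+a<n) = ≤-trans (≤-reflexive (‖‖-residue (trans [z+1]%n≡[1+a]%n (m<n⇒m%n≡m 1+a<n))))
      (⊓-monoʳ-≤ (suc a) (≤-trans (∸-monoʳ-≤ n (n≤1+n a)) (n≤1+n _)))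
    go (no 1+a≮n) = ≤-trans (≤-reflexive (‖‖-residue (trans [z+1]%n≡[1+a]%n (trans (cong (_% n) 1+a≡n) (n%n≡0 n))))) z≤n
      where 1+a≡n = ≤-antisym a<n (≮⇒≥ 1+a≮n)

  private
    residue-sum : ∀ {a b} → a < n → b < n → (a + b) % n ≡ 0 → a + b ≡ 0 ⊎ a + b ≡ n
    residue-sum {a} {b} a<n b<n ≡0 with a + b <? n
    ... | yes a+b<n = inj₁ (trans (sym (m<n⇒m%n≡m a+b<n)) ≡0)
    ... | no  a+b≮n = inj₂ (trans (sym (m∸n+n≡m n≤a+b)) (cong (_+ n) excess≡0))
      where
      n≤a+b = ≮⇒≥ a+b≮n
      excess<n : a + b ∸ n < n
      excess<n = +-cancelʳ-< n _ n (≤-trans (≤-reflexive (cong suc (m∸n+n≡m n≤a+b))) (+-mono-< a<n b<n))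
      excess≡0 : a + b ∸ n ≡ 0
      excess≡0 = trans (sym (m<n⇒m%n≡m excess<n))
        (trans (sym ([m+n]%n≡m%n (a + b ∸ n) n)) (trans (cong (_% n) (m∸n+n≡m n≤a+b)) ≡0))

  ‖‖-neg : ∀ z t K → z + t ≡ K * n → ‖ z ‖ ≡ ‖ t ‖
  ‖‖-neg z t K z+t≡Kn with residue-sum (m%n<n z n) (m%n<n t n) residues-sum≡0
    where
    residues-sum≡0 : (z % n + t % n) % n ≡ 0
    residues-sum≡0 = trans (sym (%-distribˡ-+ z t n)) (trans (cong (_% n) z+t≡Kn) (m*n%n≡0 K n))
  ... | inj₁ sum≡0 = trans (‖‖-residue (m+n≡0⇒m≡0 _ sum≡0)) (sym (‖‖-residue (m+n≡0⇒n≡0 (z % n) sum≡0)))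
  ... | inj₂ sum≡n = begin
    z % n ⊓ (n ∸ z % n)   ≡⟨ cong (z % n ⊓_) n∸a≡b ⟩
    z % n ⊓ (t % n)       ≡⟨ ⊓-comm (z % n) (t % n) ⟩
    t % n ⊓ (z % n)       ≡⟨ cong (t % n ⊓_) n∸b≡a ⟨
    t % n ⊓ (n ∸ t % n)   ∎
    where
    open ≡-Reasoning
    n∸a≡b : n ∸ z % n ≡ t % n
    n∸a≡b = trans (cong (_∸ z % n) (sym sum≡n)) (m+n∸m≡n (z % n) (t % n))
    n∸b≡a : n ∸ t % n ≡ z % n
    n∸b≡a = trans (cong (_∸ t % n) (sym sum≡n)) (m+n∸n≡m (z % n) (t % n))

  -- −(z − 1) ≡ (−z) + 1, so this is ‖‖-suc transported along ‖‖-neg.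
  ‖‖-pred : ∀ z → ‖ z + (n ∸ 1) ‖ ≤ suc ‖ z ‖
  ‖‖-pred z = begin
    ‖ z + (n ∸ 1) ‖   ≡⟨ ‖‖-neg _ (t + 1) (suc (suc (z / n))) (trans (+-rearrange z (n ∸ 1) t)
                            (trans (cong₂ _+_ z+t≡[1+q]n (m∸n+n≡m (>-nonZero⁻¹ n))) (+-comm _ n))) ⟩
    ‖ t + 1 ‖         ≤⟨ ‖‖-suc t ⟩
    suc ‖ t ‖         ≡⟨ cong suc (‖‖-neg t z (suc (z / n)) (trans (+-comm t z) z+t≡[1+q]n)) ⟩
    suc ‖ z ‖         ∎
    where
    open ≤-Reasoning
    t = n ∸ z % n
    +-rearrange : ∀ a b c → a + b + (c + 1) ≡ a + c + (b + 1)
    +-rearrange = solve-∀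
    z+t≡[1+q]n : z + t ≡ suc (z / n) * n
    z+t≡[1+q]n = begin-equality
      z + t                       ≡⟨ cong (_+ t) (m≡m%n+[m/n]*n z n) ⟩
      z % n + z / n * n + t       ≡⟨ +-rearrange′ (z % n) (z / n * n) t ⟩
      z % n + t + z / n * n       ≡⟨ cong (_+ z / n * n) (m+[n∸m]≡n (m%n≤n z n)) ⟩
      n + z / n * n               ∎
      where
      +-rearrange′ : ∀ a b c → a + b + c ≡ a + c + b
      +-rearrange′ = solve-∀

  residue-unique : ∀ {a b} i j → a < n → b < n → a + i * n ≡ b + j * n → a ≡ b
  residue-unique {a} {b} i j a<n b<n eq =
    trans (sym (m<n⇒m%n≡m a<n)) (trans (%-≡-+* a b i j eq) (m<n⇒m%n≡m b<n))

  ‖‖-+-≤ : ∀ a k → ‖ a + k ‖ ≤ ‖ a ‖ + k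
  ‖‖-+-≤ a zero    = ≤-trans (≤-reflexive (cong ‖_‖ (+-identityʳ a))) (m≤m+n _ 0)
  ‖‖-+-≤ a (suc k) = begin
    ‖ a + suc k ‖       ≡⟨ cong ‖_‖ (+-suc-last a k) ⟩
    ‖ a + k + 1 ‖       ≤⟨ ‖‖-suc (a + k) ⟩
    suc ‖ a + k ‖       ≤⟨ s≤s (‖‖-+-≤ a k) ⟩
    suc (‖ a ‖ + k)     ≡⟨ +-suc ‖ a ‖ k ⟨
    ‖ a ‖ + suc k       ∎
    where
    open ≤-Reasoning
    +-suc-last : ∀ a k → a + suc k ≡ a + k + 1
    +-suc-last = solve-∀

  ‖‖-≤-+ : ∀ a k → ‖ a ‖ ≤ ‖ a + k ‖ + k
  ‖‖-≤-+ a zero    = ≤-trans (≤-reflexive (cong ‖_‖ (sym (+-identityʳ a)))) (m≤m+n _ 0)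
  ‖‖-≤-+ a (suc k) = begin
    ‖ a ‖                          ≤⟨ ‖‖-≤-+ a k ⟩
    ‖ a + k ‖ + k                  ≡⟨ cong (λ m → m + k) (sym (trans (cong ‖_‖ a+1+k+[n∸1]≡a+k+n) (‖‖-+n (a + k)))) ⟩
    ‖ a + suc k + (n ∸ 1) ‖ + k    ≤⟨ +-monoˡ-≤ k (‖‖-pred (a + suc k)) ⟩
    suc ‖ a + suc k ‖ + k          ≡⟨ +-suc _ k ⟨
    ‖ a + suc k ‖ + suc k          ∎
    where
    open ≤-Reasoning
    +-rearrange : ∀ a k m → a + suc k + m ≡ a + k + (m + 1)
    +-rearrange = solve-∀
    a+1+k+[n∸1]≡a+k+n : a + suc k + (n ∸ 1) ≡ a + k + n
    a+1+k+[n∸1]≡a+k+n = trans (+-rearrange a k (n ∸ 1)) (cong (a + k +_) (m∸n+n≡m (>-nonZero⁻¹ n)))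

  -- c is congruent to ‖ c ‖ or to −‖ c ‖.
  ‖‖-reverse-triangle : ∀ a c → ‖ a ‖ ≤ ‖ a + c ‖ + ‖ c ‖
  ‖‖-reverse-triangle a c with ⊓-sel (c % n) (n ∸ c % n)
  ... | inj₁ ‖c‖≡r = begin
    ‖ a ‖                    ≤⟨ ‖‖-≤-+ a (c % n) ⟩
    ‖ a + c % n ‖ + c % n    ≡⟨ cong₂ _+_ (‖‖-cong (%-≡-+* _ _ (c / n) 0 a+r+qn≡a+c)) (sym ‖c‖≡r) ⟩
    ‖ a + c ‖ + ‖ c ‖        ∎
    where
    open ≤-Reasoning
    a+r+qn≡a+c : a + c % n + c / n * n ≡ a + c + 0 * n
    a+r+qn≡a+c = trans (+-assoc a _ _) (trans (cong (a +_) (sym (m≡m%n+[m/n]*n c n))) (sym (+-identityʳ _)))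
  ... | inj₂ ‖c‖≡n∸r = begin
    ‖ a ‖                                 ≡⟨ ‖‖-cong (%-≡-+* _ _ 0 (suc (c / n)) a+c+[n∸r]≡a+[1+q]n) ⟨
    ‖ a + c + (n ∸ c % n) ‖               ≤⟨ ‖‖-+-≤ (a + c) (n ∸ c % n) ⟩
    ‖ a + c ‖ + (n ∸ c % n)               ≡⟨ cong (‖ a + c ‖ +_) ‖c‖≡n∸r ⟨
    ‖ a + c ‖ + ‖ c ‖                     ∎
    where
    open ≤-Reasoning
    +-rearrange : ∀ a r q t → a + (r + q) + t ≡ a + q + (r + t)
    +-rearrange = solve-∀
    a+c+[n∸r]≡a+[1+q]n : a + c + (n ∸ c % n) + 0 * n ≡ a + suc (c / n) * n
    a+c+[n∸r]≡a+[1+q]n = begin-equality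
      a + c + (n ∸ c % n) + 0 * n                    ≡⟨ +-identityʳ _ ⟩
      a + c + (n ∸ c % n)                            ≡⟨ cong (λ m → a + m + (n ∸ c % n)) (m≡m%n+[m/n]*n c n) ⟩
      a + (c % n + c / n * n) + (n ∸ c % n)          ≡⟨ +-rearrange a (c % n) (c / n * n) (n ∸ c % n) ⟩
      a + c / n * n + (c % n + (n ∸ c % n))          ≡⟨ cong (a + c / n * n +_) (m+[n∸m]≡n (m%n≤n c n)) ⟩
      a + c / n * n + n                              ≡⟨ +-assoc a _ n ⟩
      a + (c / n * n + n)                            ≡⟨ cong (a +_) (+-comm _ n) ⟩
      a + suc (c / n) * n                            ∎

-- The potential

cappedMin : ℕ → ℕ → (ℕ → ℕ) → ℕ
cappedMin c zero    f = c
cappedMin c (suc k) f = cappedMin c k f ⊓ f k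

cappedMin≤cap : ∀ c k f → cappedMin c k f ≤ c
cappedMin≤cap c zero    f = ≤-refl
cappedMin≤cap c (suc k) f = ≤-trans (m⊓n≤m _ _) (cappedMin≤cap c k f)

cappedMin≤ : ∀ c k f {b} → b < k → cappedMin c k f ≤ f b
cappedMin≤ c (suc k) f {b} b<1+k with b ≟ k
... | yes refl = m⊓n≤n _ _
... | no  b≢k  = ≤-trans (m⊓n≤m _ _) (cappedMin≤ c k f (≤∧≢⇒< (≤-pred b<1+k) b≢k))

cappedMin-glb : ∀ c k f {L} → L ≤ c → (∀ b → b < k → L ≤ f b) → L ≤ cappedMin c k f
cappedMin-glb c zero    f L≤c L≤f = L≤c
cappedMin-glb c (suc k) f L≤c L≤f =
  ⊓-glb (cappedMin-glb c k f L≤c (λ b b<k → L≤f b (m<n⇒m<1+n b<k))) (L≤f k ≤-refl)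

cappedMin-cong : ∀ c k {f g} → (∀ b → f b ≡ g b) → cappedMin c k f ≡ cappedMin c k g
cappedMin-cong c zero    f≡g = refl
cappedMin-cong c (suc k) f≡g = cong₂ _⊓_ (cappedMin-cong c k f≡g) (f≡g k)

suc-cappedMin : ∀ c k f → suc (cappedMin c k f) ≡ cappedMin (suc c) k (suc ∘ f)
suc-cappedMin c zero    f = refl
suc-cappedMin c (suc k) f = cong (_⊓ suc (f k)) (suc-cappedMin c k f)

module Potential (n : ℕ) .{{_ : NonZero n}} (s : ℕ) where

  open CircularNorm n

  cost : ℕ → ℕ → ℕ → ℕ
  cost x b z = b + ‖ z + b * x ‖

  -- Φ of the header is Ψ (n ∸ s) s, as z + b (n − s) ≡ z − b s.  Keeping the two step lengths
  -- abstract lets one lemma (Ψ-step) handle both steps +s and −s.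
  Ψ : ℕ → ℕ → ℕ → ℕ
  Ψ x y z = cappedMin s s (λ b → cost x b z ⊓ cost y b z)

  Ψ-comm : ∀ x y z → Ψ x y z ≡ Ψ y x z
  Ψ-comm x y z = cappedMin-cong s s (λ b → ⊓-comm (cost x b z) (cost y b z))

  Ψ-periodic : ∀ x y {z z′} → z % n ≡ z′ % n → Ψ x y z ≡ Ψ x y z′
  Ψ-periodic x y {z} {z′} z≡z′ = cappedMin-cong s s (λ b → cong₂ _⊓_ (cost-periodic x b) (cost-periodic y b))
    where
    cost-periodic : ∀ x b → cost x b z ≡ cost x b z′
    cost-periodic x b = cong (b +_) (‖‖-cong (begin
      (z + b * x) % n          ≡⟨ [m+c]%n≡[m%n+c]%n z (b * x) ⟩
      (z % n + b * x) % n      ≡⟨ cong (λ a → (a + b * x) % n) z≡z′ ⟩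
      (z′ % n + b * x) % n     ≡⟨ [m+c]%n≡[m%n+c]%n z′ (b * x) ⟨
      (z′ + b * x) % n         ∎))
      where open ≡-Reasoning

  Ψ≤cost : ∀ x y z {b} → b < s → Ψ x y z ≤ cost x b z × Ψ x y z ≤ cost y b z
  Ψ≤cost x y z b<s = let Ψ≤ = cappedMin≤ s s _ b<s in ≤-trans Ψ≤ (m⊓n≤m _ _) , ≤-trans Ψ≤ (m⊓n≤n _ _)

  Ψ-glb : ∀ x y z {L} → L ≤ s → (∀ b → b < s → L ≤ cost x b z × L ≤ cost y b z) → L ≤ Ψ x y z
  Ψ-glb x y z L≤s L≤cost = cappedMin-glb s s _ L≤s (λ b b<s → ⊓-glb (proj₁ (L≤cost b b<s)) (proj₂ (L≤cost b b<s)))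

  private
    Ψ≤1+Ψ : ∀ x y z z′ → (∀ b → b < s → Ψ x y z′ ≤ suc (cost x b z) × Ψ x y z′ ≤ suc (cost y b z)) →
      Ψ x y z′ ≤ suc (Ψ x y z)
    Ψ≤1+Ψ x y z z′ bound = subst (Ψ x y z′ ≤_) (sym (suc-cappedMin s s _))
      (cappedMin-glb (suc s) s _ (≤-trans (cappedMin≤cap s s _) (n≤1+n s))
        (λ b b<s → ⊓-glb (proj₁ (bound b b<s)) (proj₂ (bound b b<s))))

    Ψ≤1+cost-at-cap : ∀ x y z′ u {b} → ¬ suc b < s → Ψ x y z′ ≤ suc (b + u)
    Ψ≤1+cost-at-cap x y z′ u {b} 1+b≮s = ≤-trans (cappedMin≤cap s s _) (≤-trans (≮⇒≥ 1+b≮s) (s≤s (m≤m+n b u)))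

  Ψ-translate : ∀ δ → (∀ z → ‖ z + δ ‖ ≤ suc ‖ z ‖) → ∀ x y z → Ψ x y (z + δ) ≤ suc (Ψ x y z)
  Ψ-translate δ ‖‖-δ x y z = Ψ≤1+Ψ x y z (z + δ) (λ b b<s →
      ≤-trans (proj₁ (Ψ≤cost x y (z + δ) b<s)) (cost-translate x b) ,
      ≤-trans (proj₂ (Ψ≤cost x y (z + δ) b<s)) (cost-translate y b))
    where
    +-swap-last : ∀ a c d → a + c + d ≡ a + d + c
    +-swap-last = solve-∀
    cost-translate : ∀ x b → cost x b (z + δ) ≤ suc (cost x b z)
    cost-translate x b = ≤-trans (+-monoʳ-≤ b (≤-trans (≤-reflexive (cong ‖_‖ (+-swap-last z δ (b * x)))) (‖‖-δ (z + b * x))))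
      (≤-reflexive (+-suc b _))

  -- Shifting z by y turns the x-term of index b into the x-term of index b + 1 (as x + y ≡ 0) and
  -- the y-term of index b + 1 into the y-term of index b; beyond index s the cap takes over.
  Ψ-step : ∀ x y → x + y ≡ n → ∀ z → Ψ x y (z + y) ≤ suc (Ψ x y z)
  Ψ-step x y x+y≡n z = Ψ≤1+Ψ x y z (z + y) (λ b b<s → via-x b , via-y b b<s)
    where
    cost-x-shift : ∀ b → cost x (suc b) (z + y) ≡ suc (cost x b z)
    cost-x-shift b = cong suc (cong (b +_) (trans (cong ‖_‖ (trans (rearrange z y x b) (cong (λ m → z + b * x + m) x+y≡n)))
      (‖‖-+n (z + b * x))))
      where
      rearrange : ∀ z y x b → z + y + suc b * x ≡ z + b * x + (x + y)
      rearrange = solve-∀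
    via-x : ∀ b → Ψ x y (z + y) ≤ suc (cost x b z)
    via-x b with suc b <? s
    ... | yes 1+b<s = ≤-trans (proj₁ (Ψ≤cost x y (z + y) 1+b<s)) (≤-reflexive (cost-x-shift b))
    ... | no  1+b≮s = Ψ≤1+cost-at-cap x y (z + y) _ 1+b≮s
    via-y : ∀ b → b < s → Ψ x y (z + y) ≤ suc (cost y b z)
    via-y zero    _   = via-x 0
    via-y (suc b) b<s = ≤-trans (proj₂ (Ψ≤cost x y (z + y) (<-trans (n<1+n b) b<s)))
      (≤-trans (≤-reflexive (cong (λ m → b + ‖ m ‖) (+-assoc z y (b * y)))) (≤-trans (n≤1+n _) (n≤1+n _)))

  Ψ-neg : ∀ x y → x + y ≡ n → ∀ z z′ K → z + z′ ≡ K * n → Ψ x y z ≡ Ψ x y z′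
  Ψ-neg x y x+y≡n z z′ K z+z′≡Kn = trans (cappedMin-cong s s swap) (Ψ-comm y x z′)
    where
    regroup : ∀ z z′ b x y → z + b * x + (z′ + b * y) ≡ z + z′ + b * (x + y)
    regroup = solve-∀
    cost-swap : ∀ x y → x + y ≡ n → ∀ b → cost x b z ≡ cost y b z′
    cost-swap x y x+y≡n b = cong (b +_) (‖‖-neg _ _ (K + b) (begin
      z + b * x + (z′ + b * y)     ≡⟨ regroup z z′ b x y ⟩
      z + z′ + b * (x + y)         ≡⟨ cong₂ (λ p m → p + b * m) z+z′≡Kn x+y≡n ⟩
      K * n + b * n                ≡⟨ *-distribʳ-+ n K b ⟨
      (K + b) * n                  ∎))
      where open ≡-Reasoning
    swap : ∀ b → cost x b z ⊓ cost y b z ≡ cost y b z′ ⊓ cost x b z′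
    swap b = cong₂ _⊓_ (cost-swap x y x+y≡n b) (cost-swap y x (trans (+-comm y x) x+y≡n) b)

-- The circulant graph C_n(1,s)

module Differences (n : ℕ) .{{_ : NonZero n}} where

  open CircularNorm n

  diff-spec : ∀ (u v : Fin n) → ∃ λ K → diff n u v + toℕ v ≡ toℕ u + K * n
  diff-spec u v with toℕ v ≤ᵇ toℕ u in v≤ᵇu
  ... | true  = 0 , trans (m∸n+n≡m (≤ᵇ⇒≤ (toℕ v) (toℕ u) (subst T (sym v≤ᵇu) _))) (sym (+-identityʳ _))
  ... | false = 1 , trans (m∸n+n≡m (≤-trans (<⇒≤ (toℕ<n v)) (m≤n+m n (toℕ u)))) (cong (toℕ u +_) (sym (*-identityˡ n)))

  diff<n : ∀ (u v : Fin n) → diff n u v < n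
  diff<n u v with toℕ v ≤ᵇ toℕ u in v≤ᵇu
  ... | true  = ≤-<-trans (m∸n≤m (toℕ u) (toℕ v)) (toℕ<n u)
  ... | false = +-cancelʳ-< (toℕ v) _ n (begin-strict
    toℕ u + n ∸ toℕ v + toℕ v   ≡⟨ m∸n+n≡m (≤-trans (<⇒≤ (toℕ<n v)) (m≤n+m n (toℕ u))) ⟩
    toℕ u + n                   <⟨ +-monoˡ-< n (≰⇒> (λ v≤u → subst T v≤ᵇu (≤⇒≤ᵇ v≤u))) ⟩
    toℕ v + n                   ≡⟨ +-comm (toℕ v) n ⟩
    n + toℕ v                   ∎)
    where open ≤-Reasoning

  diff-self : ∀ (x : Fin n) → diff n x x ≡ 0
  diff-self x with diff-spec x x
  ... | K , d+x≡x+Kn = residue-unique 0 K (diff<n x x) (>-nonZero⁻¹ n)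
    (+-cancelʳ-≡ (toℕ x) _ _ (trans (cong (_+ toℕ x) (+-identityʳ _))
      (trans d+x≡x+Kn (+-comm (toℕ x) (K * n)))))

  diff-injectiveʳ : ∀ (u v v′ : Fin n) → diff n u v ≡ diff n u v′ → v ≡ v′
  diff-injectiveʳ u v v′ d≡d′ with diff-spec u v | diff-spec u v′
  ... | K , d+v≡u+Kn | K′ , d′+v′≡u+K′n = toℕ-injective (residue-unique K′ K (toℕ<n v) (toℕ<n v′)
    (+-cancelˡ-≡ (diff n u v) _ _ (begin
      diff n u v + (toℕ v + K′ * n)     ≡⟨ +-assoc (diff n u v) (toℕ v) (K′ * n) ⟨
      diff n u v + toℕ v + K′ * n       ≡⟨ cong (_+ K′ * n) d+v≡u+Kn ⟩
      toℕ u + K * n + K′ * n            ≡⟨ +-swap-last (toℕ u) (K * n) (K′ * n) ⟩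
      toℕ u + K′ * n + K * n            ≡⟨ cong (_+ K * n) (trans (sym d′+v′≡u+K′n) (cong (_+ toℕ v′) (sym d≡d′))) ⟩
      diff n u v + toℕ v′ + K * n       ≡⟨ +-assoc (diff n u v) (toℕ v′) (K * n) ⟩
      diff n u v + (toℕ v′ + K * n)     ∎)))
    where
    open ≡-Reasoning
    +-swap-last : ∀ a b c → a + b + c ≡ a + c + b
    +-swap-last = solve-∀

  diff-flip : ∀ (u v : Fin n) → 0 < diff n u v → diff n v u ≡ n ∸ diff n u v
  diff-flip u v d>0 with diff-spec u v | diff-spec v u
  ... | K , d+v≡u+Kn | K′ , e+u≡v+K′n = residue-unique 1 (K + K′) (diff<n v u) (∸-monoʳ-< d>0 (<⇒≤ (diff<n u v)))
    (+-cancelʳ-≡ d _ _ (begin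
      e + 1 * n + d                  ≡⟨ regroup₁ e d n ⟨
      e + d + n                      ≡⟨ cong (_+ n) e+d≡[K+K′]n ⟩
      (K + K′) * n + n               ≡⟨ cong ((K + K′) * n +_) (m∸n+n≡m (<⇒≤ (diff<n u v))) ⟨
      (K + K′) * n + (n ∸ d + d)     ≡⟨ regroup₂ ((K + K′) * n) (n ∸ d) d ⟩
      n ∸ d + (K + K′) * n + d       ∎))
    where
    open ≡-Reasoning
    d = diff n u v
    e = diff n v u
    regroup₁ : ∀ e d n → e + d + n ≡ e + 1 * n + d
    regroup₁ = solve-∀
    regroup₂ : ∀ a b c → a + (b + c) ≡ b + a + c
    regroup₂ = solve-∀
    e+d≡[K+K′]n : e + d ≡ (K + K′) * n
    e+d≡[K+K′]n = +-cancelʳ-≡ (toℕ u + toℕ v) _ _ (begin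
      e + d + (toℕ u + toℕ v)              ≡⟨ shuffle₁ e d (toℕ u) (toℕ v) ⟩
      (e + toℕ u) + (d + toℕ v)            ≡⟨ cong₂ _+_ e+u≡v+K′n d+v≡u+Kn ⟩
      (toℕ v + K′ * n) + (toℕ u + K * n)   ≡⟨ shuffle₂ (toℕ u) (toℕ v) K K′ n ⟩
      (K + K′) * n + (toℕ u + toℕ v)       ∎)
      where
      shuffle₁ : ∀ e d a b → e + d + (a + b) ≡ (e + a) + (d + b)
      shuffle₁ = solve-∀
      shuffle₂ : ∀ a b K K′ n → (b + K′ * n) + (a + K * n) ≡ (K + K′) * n + (a + b)
      shuffle₂ = solve-∀

  diff-step : ∀ (x a b : Fin n) δ → δ + diff n a b ≡ n → (diff n a x + δ) % n ≡ diff n b x % n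
  diff-step x a b δ δ+d≡n with diff-spec a x | diff-spec b x | diff-spec a b
  ... | Ka , dax | Kb , dbx | Kd , dab = %-≡-+* _ _ (Kb + Kd) (Ka + 1) (+-cancelʳ-≡ (toℕ x + diff n a b) _ _ (begin
      diff n a x + δ + (Kb + Kd) * n + (toℕ x + diff n a b)
        ≡⟨ shuffle₁ (diff n a x) δ Kb Kd (toℕ x) (diff n a b) n ⟩
      (diff n a x + toℕ x) + (δ + diff n a b) + (Kb + Kd) * n
        ≡⟨ cong₂ (λ p q → p + q + (Kb + Kd) * n) dax δ+d≡n ⟩
      toℕ a + Ka * n + n + (Kb + Kd) * n
        ≡⟨ shuffle₂ (toℕ a) Ka Kb Kd n ⟩
      toℕ a + Kd * n + Kb * n + (Ka + 1) * n
        ≡⟨ cong (λ p → p + Kb * n + (Ka + 1) * n) dab ⟨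
      diff n a b + toℕ b + Kb * n + (Ka + 1) * n
        ≡⟨ shuffle₃ (toℕ b) Kb (diff n a b) Ka n ⟩
      diff n a b + (toℕ b + Kb * n) + (Ka + 1) * n
        ≡⟨ cong (λ p → diff n a b + p + (Ka + 1) * n) dbx ⟨
      diff n a b + (diff n b x + toℕ x) + (Ka + 1) * n
        ≡⟨ shuffle₄ (diff n b x) Ka (toℕ x) (diff n a b) n ⟩
      diff n b x + (Ka + 1) * n + (toℕ x + diff n a b) ∎))
    where
    open ≡-Reasoning
    shuffle₁ : ∀ a δ Kb Kd x d n → a + δ + (Kb + Kd) * n + (x + d) ≡ (a + x) + (δ + d) + (Kb + Kd) * n
    shuffle₁ = solve-∀
    shuffle₂ : ∀ a Ka Kb Kd n → a + Ka * n + n + (Kb + Kd) * n ≡ a + Kd * n + Kb * n + (Ka + 1) * n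
    shuffle₂ = solve-∀
    shuffle₃ : ∀ b Kb d Ka n → d + b + Kb * n + (Ka + 1) * n ≡ d + (b + Kb * n) + (Ka + 1) * n
    shuffle₃ = solve-∀
    shuffle₄ : ∀ e Ka x d n → d + (e + x) + (Ka + 1) * n ≡ e + (Ka + 1) * n + (x + d)
    shuffle₄ = solve-∀

  diff-translate : ∀ (x y : Fin n) → diff n y x % n ≡ (toℕ y + (n ∸ toℕ x)) % n
  diff-translate x y with diff-spec y x
  ... | K , d+x≡y+Kn = %-≡-+* _ _ 1 K (+-cancelʳ-≡ (toℕ x) _ _ (begin
      diff n y x + 1 * n + toℕ x              ≡⟨ shuffle₁ (diff n y x) (toℕ x) n ⟩
      diff n y x + toℕ x + n                  ≡⟨ cong (_+ n) d+x≡y+Kn ⟩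
      toℕ y + K * n + n                       ≡⟨ cong (λ m → toℕ y + K * n + m) (m∸n+n≡m (<⇒≤ (toℕ<n x))) ⟨
      toℕ y + K * n + (n ∸ toℕ x + toℕ x)     ≡⟨ shuffle₂ (toℕ y) (K * n) (n ∸ toℕ x) (toℕ x) ⟩
      toℕ y + (n ∸ toℕ x) + K * n + toℕ x     ∎))
    where
    open ≡-Reasoning
    shuffle₁ : ∀ d x n → d + 1 * n + x ≡ d + x + n
    shuffle₁ = solve-∀
    shuffle₂ : ∀ a b c d → a + b + (c + d) ≡ a + c + b + d
    shuffle₂ = solve-∀

IsStep : (n s d : ℕ) → Set
IsStep n s d = d ≡ 1 ⊎ d ≡ n ∸ 1 ⊎ d ≡ s ⊎ d ≡ n ∸ s

module Adjacency (n s : ℕ) .{{_ : NonZero n}} where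

  open Differences n

  Adj⇒IsStep : ∀ u v → Adj n s u v → IsStep n s (diff n u v)
  Adj⇒IsStep u v =
    ⊎-map (≡ᵇ⇒≡ _ _) (⊎-map (≡ᵇ⇒≡ _ _) (⊎-map (≡ᵇ⇒≡ _ _) (≡ᵇ⇒≡ _ _) ∘ to T-∨) ∘ to T-∨) ∘ to T-∨

  IsStep⇒Adj : ∀ u v → IsStep n s (diff n u v) → Adj n s u v
  IsStep⇒Adj u v =
    from T-∨ ∘ ⊎-map (≡⇒≡ᵇ _ _) (from T-∨ ∘ ⊎-map (≡⇒≡ᵇ _ _) (from T-∨ ∘ ⊎-map (≡⇒≡ᵇ _ _) (≡⇒≡ᵇ _ _)))

  Adj-sym : 0 < s → s < n → ∀ u v → Adj n s u v → Adj n s v u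
  Adj-sym 0<s s<n u v uv = IsStep⇒Adj v u (flip (Adj⇒IsStep u v uv))
    where
    flip-via : ∀ {d} → diff n u v ≡ d → 0 < d → diff n v u ≡ n ∸ d
    flip-via refl = diff-flip u v
    flip : IsStep n s (diff n u v) → IsStep n s (diff n v u)
    flip (inj₁ d≡1) = inj₂ (inj₁ (flip-via d≡1 (s≤s z≤n)))
    flip (inj₂ (inj₁ d≡n∸1)) =
      inj₁ (trans (flip-via d≡n∸1 (m<n⇒0<n∸m (<-≤-trans (s≤s 0<s) s<n))) (m∸[m∸n]≡n (>-nonZero⁻¹ n)))
    flip (inj₂ (inj₂ (inj₁ d≡s))) = inj₂ (inj₂ (inj₂ (flip-via d≡s 0<s)))
    flip (inj₂ (inj₂ (inj₂ d≡n∸s))) =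
      inj₂ (inj₂ (inj₁ (trans (flip-via d≡n∸s (m<n⇒0<n∸m s<n)) (m∸[m∸n]≡n (<⇒≤ s<n)))))

module CirculantPotential (n s : ℕ) .{{_ : NonZero n}} (s≤n : s ≤ n) where

  open CircularNorm n
  open Potential n s
  open Differences n
  open Adjacency n s

  Φ : ℕ → ℕ
  Φ = Ψ (n ∸ s) s

  Φ-periodic : ∀ {z z′} → z % n ≡ z′ % n → Φ z ≡ Φ z′
  Φ-periodic = Ψ-periodic (n ∸ s) s

  Φ-neg : ∀ {z z′} K → z + z′ ≡ K * n → Φ z ≡ Φ z′
  Φ-neg K = Ψ-neg (n ∸ s) s (m∸n+n≡m s≤n) _ _ K

  Φ-zero : 0 < s → Φ 0 ≡ 0
  Φ-zero 0<s = n≤0⇒n≡0 (≤-trans (proj₁ (Ψ≤cost (n ∸ s) s 0 0<s))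
    (≤-trans (‖‖≤% 0) (≤-reflexive (m<n⇒m%n≡m (>-nonZero⁻¹ n)))))

  private
    Φ-along : ∀ (x a b : Fin n) δ → δ + diff n a b ≡ n →
      Φ (diff n a x + δ) ≤ suc (Φ (diff n a x)) → Φ (diff n b x) ≤ suc (Φ (diff n a x))
    Φ-along x a b δ δ+d≡n = ≤-trans (≤-reflexive (Ψ-periodic (n ∸ s) s (sym (diff-step x a b δ δ+d≡n))))

  Φ-adjacent : ∀ (x a b : Fin n) → Adj n s a b → Φ (diff n b x) ≤ suc (Φ (diff n a x))
  Φ-adjacent x a b ab with Adj⇒IsStep a b ab
  ... | inj₁ d≡1 = Φ-along x a b (n ∸ 1) (trans (cong (n ∸ 1 +_) d≡1) (m∸n+n≡m (>-nonZero⁻¹ n)))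
    (Ψ-translate (n ∸ 1) ‖‖-pred (n ∸ s) s _)
  ... | inj₂ (inj₁ d≡n∸1) = Φ-along x a b 1 (trans (cong (1 +_) d≡n∸1) (m+[n∸m]≡n (>-nonZero⁻¹ n)))
    (Ψ-translate 1 ‖‖-suc (n ∸ s) s _)
  ... | inj₂ (inj₂ (inj₁ d≡s)) = Φ-along x a b (n ∸ s) (trans (cong (n ∸ s +_) d≡s) (m∸n+n≡m s≤n))
    (subst₂ _≤_ (Ψ-comm s (n ∸ s) _) (cong suc (Ψ-comm s (n ∸ s) _)) (Ψ-step s (n ∸ s) (m+[n∸m]≡n s≤n) _))
  ... | inj₂ (inj₂ (inj₂ d≡n∸s)) = Φ-along x a b s (trans (cong (s +_) d≡n∸s) (m+[n∸m]≡n s≤n))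
    (Ψ-step (n ∸ s) s (m∸n+n≡m s≤n) _)

  Φ≤length : ∀ (x y a : Fin n) p → Linked (Adj n s) (a ∷ p) → last (a ∷ p) ≡ just y →
    Φ (diff n y x) ≤ Φ (diff n a x) + length p
  Φ≤length x y a []      [-]           refl = ≤-reflexive (sym (+-identityʳ _))
  Φ≤length x y a (b ∷ p) (ab ∷ linked) ends-y = begin
    Φ (diff n y x)                   ≤⟨ Φ≤length x y b p linked ends-y ⟩
    Φ (diff n b x) + length p        ≤⟨ +-monoˡ-≤ (length p) (Φ-adjacent x a b ab) ⟩
    suc (Φ (diff n a x)) + length p  ≡⟨ +-suc _ _ ⟨
    Φ (diff n a x) + length (b ∷ p)  ∎
    where open ≤-Reasoning


eqF-sound : ∀ {m} {a b : Fin m} → T (eqF a b) → a ≡ b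
eqF-sound {a = a} {b} t with a Fin.≟ b
... | yes a≡b = a≡b

∑-indicator-eqF : ∀ {m} (a : Fin m) → ∑[ u < m ] indicator (eqF a u) ≡ 1
∑-indicator-eqF {suc m} Fin.zero    = cong suc (∑-zero m (λ _ → refl))
∑-indicator-eqF {suc m} (Fin.suc a) = ∑-indicator-eqF a

∑∑-indicator-eqF : ∀ {m} (a b : Fin m) → ∑[ u < m ] ∑[ v < m ] indicator (eqF a u ∧ eqF b v) ≡ 1
∑∑-indicator-eqF {m} a b = begin
  ∑[ u < m ] ∑[ v < m ] indicator (eqF a u ∧ eqF b v)
    ≡⟨ sum-cong-≗ (λ u → trans (sum-cong-≗ (λ v → indicator-∧ (eqF a u) (eqF b v)))
                              (∑-distribˡ-* m (indicator (eqF a u)) _)) ⟩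
  ∑[ u < m ] (indicator (eqF a u) * ∑[ v < m ] indicator (eqF b v))
    ≡⟨ sum-cong-≗ (λ u → trans (cong (indicator (eqF a u) *_) (∑-indicator-eqF b)) (*-identityʳ _)) ⟩
  ∑[ u < m ] indicator (eqF a u)
    ≡⟨ ∑-indicator-eqF a ⟩
  1 ∎
  where open ≡-Reasoning

uses-∷ : ∀ {m} (a b : Fin m) p u v → T (uses (a ∷ b ∷ p) u v) →
  (a ≡ u × b ≡ v) ⊎ (a ≡ v × b ≡ u) ⊎ T (uses (b ∷ p) u v)
uses-∷ a b p u v t with to (T-∨ {eqF a u ∧ eqF b v ∨ eqF a v ∧ eqF b u}) t
... | inj₂ later = inj₂ (inj₂ later)
... | inj₁ edge with to (T-∨ {eqF a u ∧ eqF b v}) edge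
...   | inj₁ ab≡uv = inj₁ (eqF-sound (proj₁ (to T-∧ ab≡uv)) , eqF-sound (proj₂ (to T-∧ ab≡uv)))
...   | inj₂ ab≡vu = inj₂ (inj₁ (eqF-sound (proj₁ (to T-∧ ab≡vu)) , eqF-sound (proj₂ (to T-∧ ab≡vu))))

uses⇒∈ : ∀ {m} (p : List (Fin m)) u v → T (uses p u v) → u ∈ p × v ∈ p
uses⇒∈ (a ∷ b ∷ p) u v t = [ (λ { (refl , refl) → here refl , there (here refl) })
                           , [ (λ { (refl , refl) → there (here refl) , here refl })
                             , ×-map there there ∘ uses⇒∈ (b ∷ p) u v ]′ ]′ (uses-∷ a b p u v t)

∑∑-uses : ∀ {m} (a : Fin m) p → Unique (a ∷ p) → ∑[ u < m ] ∑[ v < m ] indicator (uses (a ∷ p) u v) ≡ 2 * length p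
∑∑-uses {m} a [] _ = ∑-zero m (λ u → ∑-zero m (λ v → refl))
∑∑-uses {m} a (b ∷ q) ((a≢b ∷ a∉q) ∷ unique) = begin
  ∑[ u < m ] ∑[ v < m ] indicator ((E₁ u v ∨ E₂ u v) ∨ U u v)
    ≡⟨ sum-cong-≗ (λ u → sum-cong-≗ (λ v → split u v)) ⟩
  ∑[ u < m ] ∑[ v < m ] (indicator (E₁ u v) + indicator (E₂ u v) + indicator (U u v))
    ≡⟨ sum-cong-≗ (λ u → trans (∑-distrib-+ m (λ v → I₁ u v + I₂ u v) (I₃ u))
                              (cong (_+ ∑[ v < m ] I₃ u v) (∑-distrib-+ m (I₁ u) (I₂ u)))) ⟩
  ∑[ u < m ] (∑[ v < m ] indicator (E₁ u v) + ∑[ v < m ] indicator (E₂ u v) + ∑[ v < m ] indicator (U u v))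
    ≡⟨ trans (∑-distrib-+ m (λ u → ∑[ v < m ] I₁ u v + ∑[ v < m ] I₂ u v) (λ u → ∑[ v < m ] I₃ u v))
         (cong (_+ ∑[ u < m ] ∑[ v < m ] I₃ u v) (∑-distrib-+ m (λ u → ∑[ v < m ] I₁ u v) (λ u → ∑[ v < m ] I₂ u v))) ⟩
  (∑[ u < m ] ∑[ v < m ] indicator (E₁ u v)) + (∑[ u < m ] ∑[ v < m ] indicator (E₂ u v)) + (∑[ u < m ] ∑[ v < m ] indicator (U u v))
    ≡⟨ cong₂ (λ x y → x + y + ∑[ u < m ] ∑[ v < m ] I₃ u v) (∑∑-indicator-eqF a b) (trans (∑-swap m m _) (∑∑-indicator-eqF a b)) ⟩
  2 + ∑[ u < m ] ∑[ v < m ] indicator (U u v)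
    ≡⟨ cong (2 +_) (∑∑-uses b q unique) ⟩
  2 + 2 * length q
    ≡⟨ *-suc 2 (length q) ⟨
  2 * length (b ∷ q) ∎
  where
  open ≡-Reasoning
  E₁ E₂ U : Fin m → Fin m → Bool
  E₁ u v = eqF a u ∧ eqF b v
  E₂ u v = eqF a v ∧ eqF b u
  U  u v = uses (b ∷ q) u v
  I₁ I₂ I₃ : Fin m → Fin m → ℕ
  I₁ u v = indicator (E₁ u v)
  I₂ u v = indicator (E₂ u v)
  I₃ u v = indicator (U u v)
  a∉b∷q : a ∉ b ∷ q
  a∉b∷q (here a≡b) = a≢b a≡b
  a∉b∷q (there a∈q) = All¬⇒¬Any a∉q a∈q
  split : ∀ u v → indicator ((E₁ u v ∨ E₂ u v) ∨ U u v) ≡ indicator (E₁ u v) + indicator (E₂ u v) + indicator (U u v)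
  split u v = trans (indicator-∨ _ _ edge∉later) (cong (_+ _) (indicator-∨ _ _ not-both))
    where
    not-both : T (E₁ u v) → T (E₂ u v) → ⊥
    not-both e₁ e₂ = a≢b (trans (eqF-sound (proj₁ (to T-∧ e₁))) (sym (eqF-sound (proj₂ (to T-∧ e₂)))))
    edge∉later : T (E₁ u v ∨ E₂ u v) → T (U u v) → ⊥
    edge∉later e later with to T-∨ e | uses⇒∈ (b ∷ q) u v later
    ... | inj₁ e₁ | u∈ , _ = a∉b∷q (subst (_∈ b ∷ q) (sym (eqF-sound (proj₁ (to T-∧ e₁)))) u∈)
    ... | inj₂ e₂ | _ , v∈ = a∉b∷q (subst (_∈ b ∷ q) (sym (eqF-sound (proj₁ (to T-∧ e₂)))) v∈)

sum-map-allFin : ∀ n (h : Fin n → ℕ) → ListAction.sum (map h (allFin n)) ≡ ∑[ i < n ] h i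
sum-map-allFin n h = trans (cong ListAction.sum (map-tabulate (λ i → i) h)) (sum-tabulate n h)
  where
  sum-tabulate : ∀ n (h : Fin n → ℕ) → ListAction.sum (tabulate h) ≡ ∑[ i < n ] h i
  sum-tabulate zero    h = refl
  sum-tabulate (suc n) h = cong (h Fin.zero +_) (sum-tabulate n (h ∘ Fin.suc))

sum-concatMap : ∀ {A : Set} (g : A → List ℕ) xs → ListAction.sum (concatMap g xs) ≡ ListAction.sum (map (ListAction.sum ∘ g) xs)
sum-concatMap g []       = refl
sum-concatMap g (x ∷ xs) = trans (sum-++ (g x) (concatMap g xs)) (cong (ListAction.sum (g x) +_) (sum-concatMap g xs))

∈⇒≤foldr-⊔ : ∀ {m xs} → m ∈ xs → m ≤ foldr _⊔_ 0 xs
∈⇒≤foldr-⊔ (here refl)  = m≤m⊔n _ _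
∈⇒≤foldr-⊔ {xs = x ∷ _} (there m∈xs) = ≤-trans (∈⇒≤foldr-⊔ m∈xs) (m≤n⊔m x _)

∈-allPairs : ∀ {A : Set} {n} (f : Fin n → Fin n → A) u v → f u v ∈ concatMap (λ u → map (f u) (allFin n)) (allFin n)
∈-allPairs f u v = ∈-concatMap⁺ _ (any-map (λ { refl → ∈-map⁺ (f u) (∈-allFin v) }) (∈-allFin u))

module EdgeLoads (n s : ℕ) .{{_ : NonZero n}} (R : Routing n) where

  open Differences n

  routed : Fin n → Fin n → Fin n → Fin n → ℕ
  routed x y u v = indicator (not (eqF x y) ∧ uses (R x y) u v)

  edgeLoad : Fin n → Fin n → ℕ
  edgeLoad u v = if adj n s u v then load n R u v else 0

  load≡∑routed : ∀ u v → load n R u v ≡ ∑[ x < n ] ∑[ y < n ] routed x y u v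
  load≡∑routed u v = trans (sum-concatMap _ (allFin n))
    (trans (sum-map-allFin n _) (sum-cong-≗ (λ x → sum-map-allFin n (λ y → routed x y u v))))

  edgeLoad≤maxLoad : ∀ u v → edgeLoad u v ≤ maxLoad n s R
  edgeLoad≤maxLoad u v = ∈⇒≤foldr-⊔ (∈-allPairs edgeLoad u v)

  degree≤4 : ∀ u → ∑[ v < n ] indicator (adj n s u v) ≤ 4
  degree≤4 u = begin
    ∑[ v < n ] indicator (adj n s u v)            ≤⟨ ∑-mono-≤ n split ⟩
    ∑[ v < n ] (I 1 v + (I (n ∸ 1) v + (I s v + I (n ∸ s) v)))
      ≡⟨ trans (∑-distrib-+ n (I 1) _) (cong (∑[ v < n ] I 1 v +_) (trans (∑-distrib-+ n (I (n ∸ 1)) _)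
           (cong (∑[ v < n ] I (n ∸ 1) v +_) (∑-distrib-+ n (I s) (I (n ∸ s)))))) ⟩
    ∑[ v < n ] I 1 v + (∑[ v < n ] I (n ∸ 1) v + (∑[ v < n ] I s v + ∑[ v < n ] I (n ∸ s) v))
      ≤⟨ +-mono-≤ (at-most-one 1) (+-mono-≤ (at-most-one (n ∸ 1)) (+-mono-≤ (at-most-one s) (at-most-one (n ∸ s)))) ⟩
    4 ∎
    where
    open ≤-Reasoning
    I : ℕ → Fin n → ℕ
    I d v = indicator (diff n u v ≡ᵇ d)
    split : ∀ v → indicator (adj n s u v) ≤ I 1 v + (I (n ∸ 1) v + (I s v + I (n ∸ s) v))
    split v = ≤-trans (indicator-∨-≤ (diff n u v ≡ᵇ 1) _) (+-monoʳ-≤ (I 1 v)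
      (≤-trans (indicator-∨-≤ (diff n u v ≡ᵇ (n ∸ 1)) _) (+-monoʳ-≤ (I (n ∸ 1) v)
        (indicator-∨-≤ (diff n u v ≡ᵇ s) _))))
    at-most-one : ∀ d → ∑[ v < n ] I d v ≤ 1
    at-most-one d = ∑-indicator-≤1 n _ (λ v v′ t t′ → diff-injectiveʳ u v v′ (trans (≡ᵇ⇒≡ _ _ t) (sym (≡ᵇ⇒≡ _ _ t′))))

  ∑edgeLoad≤ : ∑[ u < n ] ∑[ v < n ] edgeLoad u v ≤ maxLoad n s R * (n * 4)
  ∑edgeLoad≤ = begin
    ∑[ u < n ] ∑[ v < n ] edgeLoad u v                      ≤⟨ ∑-mono-≤ n (λ u → ∑-mono-≤ n (λ v → edgeLoad≤ u v)) ⟩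
    ∑[ u < n ] ∑[ v < n ] (L * indicator (adj n s u v))     ≡⟨ trans (sum-cong-≗ (λ u → ∑-distribˡ-* n L (λ v → indicator (adj n s u v))))
                                                                 (∑-distribˡ-* n L (λ u → ∑[ v < n ] indicator (adj n s u v))) ⟩
    L * ∑[ u < n ] ∑[ v < n ] indicator (adj n s u v)       ≤⟨ *-monoʳ-≤ L (∑-mono-≤ n degree≤4) ⟩
    L * ∑[ u < n ] 4                                        ≡⟨ cong (L *_) (∑-const n 4) ⟩
    L * (n * 4)                                             ∎
    where
    open ≤-Reasoning
    L = maxLoad n s R
    edgeLoad≤ : ∀ u v → edgeLoad u v ≤ L * indicator (adj n s u v)
    edgeLoad≤ u v with adj n s u v | edgeLoad≤maxLoad u v
    ... | true  | load≤L = ≤-trans load≤L (≤-reflexive (sym (*-identityʳ L)))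
    ... | false | _      = z≤n

module RoutingBound (n s : ℕ) .{{_ : NonZero n}} (0<s : 0 < s) (s<n : s < n)
  (R : Routing n) (all-to-all : IsAllToAllRouting n s R) where

  open EdgeLoads n s R
  open Differences n
  open Adjacency n s
  open CirculantPotential n s (<⇒≤ s<n)

  uses⇒Adj : ∀ p → Linked (Adj n s) p → ∀ u v → T (uses p u v) → Adj n s u v
  uses⇒Adj (a ∷ b ∷ p) (ab ∷ linked) u v t =
    [ (λ { (refl , refl) → ab }) , [ (λ { (refl , refl) → Adj-sym 0<s s<n a b ab }) , uses⇒Adj (b ∷ p) linked u v ]′ ]′
      (uses-∷ a b p u v t)

  ∑routed≤edgeLoad : ∀ u v → ∑[ x < n ] ∑[ y < n ] routed x y u v ≤ edgeLoad u v
  ∑routed≤edgeLoad u v with adj n s u v in uv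
  ... | true  = ≤-reflexive (sym (load≡∑routed u v))
  ... | false = ≤-reflexive (∑-zero n (λ x → ∑-zero n (λ y → unrouted x y)))
    where
    unrouted : ∀ x y → routed x y u v ≡ 0
    unrouted x y with x Fin.≟ y
    ... | yes _   = refl
    ... | no  x≢y with uses (R x y) u v in used
    ...   | false = refl
    ...   | true  = ⊥-elim (subst T uv (uses⇒Adj (R x y) (proj₁ (proj₂ (proj₂ (all-to-all x y x≢y)))) u v (subst T (sym used) _)))

  Φ[diff-x-x]≡0 : ∀ x → Φ (diff n x x) ≡ 0
  Φ[diff-x-x]≡0 x = trans (cong Φ (diff-self x)) (Φ-zero 0<s)

  2Φ≤∑routed : ∀ x y → 2 * Φ (diff n y x) ≤ ∑[ u < n ] ∑[ v < n ] routed x y u v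
  2Φ≤∑routed x y with x Fin.≟ y | all-to-all x y
  ... | yes refl | _ = ≤-trans (≤-reflexive (cong (2 *_) (Φ[diff-x-x]≡0 x))) z≤n
  ... | no  x≢y | path with R x y | path x≢y
  ...   | _ ∷ p | refl , ends-y , linked , unique = begin
    2 * Φ (diff n y x)                       ≤⟨ *-monoʳ-≤ 2 (Φ≤length x y x p linked ends-y) ⟩
    2 * (Φ (diff n x x) + length p)          ≡⟨ cong (λ m → 2 * (m + length p)) (Φ[diff-x-x]≡0 x) ⟩
    2 * length p                             ≡⟨ ∑∑-uses x p unique ⟨
    ∑[ u < n ] ∑[ v < n ] indicator (uses (x ∷ p) u v) ∎
    where open ≤-Reasoning

  ∑Φ-row : ∀ x → ∑[ y < n ] Φ (diff n y x) ≡ ∑ℕ[ z < n ] Φ z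
  ∑Φ-row x = begin
    ∑[ y < n ] Φ (diff n y x)                 ≡⟨ sum-cong-≗ (λ y → Φ-periodic (diff-translate x y)) ⟩
    ∑[ y < n ] Φ (toℕ y + (n ∸ toℕ x))        ≡⟨ ∑-toℕ n (λ i → Φ (i + (n ∸ toℕ x))) ⟩
    ∑ℕ[ i < n ] Φ (i + (n ∸ toℕ x))           ≡⟨ ∑ℕ-periodic-shift n Φ (λ z → Φ-periodic ([m+n]%n≡m%n z n)) (n ∸ toℕ x) ⟩
    ∑ℕ[ z < n ] Φ z                           ∎
    where open ≡-Reasoning

  ∑Φ≤2*maxLoad : ∑ℕ[ z < n ] Φ z ≤ 2 * maxLoad n s R
  ∑Φ≤2*maxLoad = *-cancelˡ-≤ 2 (*-cancelˡ-≤ n (begin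
    n * (2 * X)                                                       ≡⟨ *-comm-left n 2 X ⟩
    2 * (n * X)                                                       ≡⟨ cong (2 *_) (trans (sum-cong-≗ ∑Φ-row) (∑-const n X)) ⟨
    2 * (∑[ x < n ] ∑[ y < n ] Φ (diff n y x))                        ≡⟨ trans (sum-cong-≗ (λ x → ∑-distribˡ-* n 2 (λ y → Φ (diff n y x))))
                                                                           (∑-distribˡ-* n 2 (λ x → ∑[ y < n ] Φ (diff n y x))) ⟨
    ∑[ x < n ] ∑[ y < n ] (2 * Φ (diff n y x))                        ≤⟨ ∑-mono-≤ n (λ x → ∑-mono-≤ n (2Φ≤∑routed x)) ⟩
    ∑[ x < n ] ∑[ y < n ] ∑[ u < n ] ∑[ v < n ] routed x y u v        ≡⟨ ∑∑-swap n n routed ⟩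
    ∑[ u < n ] ∑[ v < n ] ∑[ x < n ] ∑[ y < n ] routed x y u v        ≤⟨ ∑-mono-≤ n (λ u → ∑-mono-≤ n (∑routed≤edgeLoad u)) ⟩
    ∑[ u < n ] ∑[ v < n ] edgeLoad u v                                ≤⟨ ∑edgeLoad≤ ⟩
    L * (n * 4)                                                       ≡⟨ reorder L n ⟩
    n * (2 * (2 * L))                                                 ∎))
    where
    open ≤-Reasoning
    X = ∑ℕ[ z < n ] Φ z
    L = maxLoad n s R
    *-comm-left : ∀ a b c → a * (b * c) ≡ b * (a * c)
    *-comm-left = solve-∀
    reorder : ∀ L n → L * (n * 4) ≡ n * (2 * (2 * L))
    reorder = solve-∀

-- Multiples of s modulo n

module MultiplesOfStep (n s : ℕ) .{{_ : NonZero n}} where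

  open CircularNorm n

  Dichotomy : ℕ → Set
  Dichotomy b = ‖ b * s ‖ ≤ b ⊎ s + 1 ≤ ‖ b * s ‖ + b

  near : ∀ {b t} K → b * s ≡ t + K * n → t ≤ b → Dichotomy b
  near {b} {t} K bs≡t+Kn t≤b = inj₁ (begin
    ‖ b * s ‖          ≤⟨ ‖‖≤% (b * s) ⟩
    b * s % n          ≡⟨ %-≡-+* _ _ 0 K (trans (+-identityʳ _) bs≡t+Kn) ⟩
    t % n              ≤⟨ m%n≤m t n ⟩
    t                  ≤⟨ t≤b ⟩
    b                  ∎)
    where open ≤-Reasoning

  near-neg : ∀ {b t} K → b * s + t ≡ K * n → t ≤ b → Dichotomy b
  near-neg {b} {t} K bs+t≡Kn t≤b = inj₁ (begin
    ‖ b * s ‖          ≡⟨ ‖‖-neg _ _ K bs+t≡Kn ⟩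
    ‖ t ‖              ≤⟨ ‖‖≤% t ⟩
    t % n              ≤⟨ m%n≤m t n ⟩
    t                  ≤⟨ t≤b ⟩
    b                  ∎)
    where open ≤-Reasoning

  far : ∀ {b ρ} K → b ≤ s → b * s ≡ ρ + K * n → s + 1 ≤ ρ + b → ρ + s + 1 ≤ n + b → Dichotomy b
  far {b} {ρ} K b≤s bs≡ρ+Kn s+1≤ρ+b ρ+s+1≤n+b = inj₂ (begin
    s + 1                           ≤⟨ ⊓-glb s+1≤ρ+b s+1≤n∸ρ+b ⟩
    (ρ + b) ⊓ (n ∸ ρ + b)           ≡⟨ +-distribʳ-⊓ b ρ (n ∸ ρ) ⟨
    ρ ⊓ (n ∸ ρ) + b                 ≡⟨ cong (_+ b) (‖‖-residue bs%n≡ρ) ⟨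
    ‖ b * s ‖ + b                   ∎)
    where
    open ≤-Reasoning
    ρ<n : ρ < n
    ρ<n = +-cancelʳ-≤ s (suc ρ) n (≤-trans (≤-reflexive (shuffle ρ s)) (≤-trans ρ+s+1≤n+b (+-monoʳ-≤ n b≤s)))
      where
      shuffle : ∀ ρ s → suc ρ + s ≡ ρ + s + 1
      shuffle = solve-∀
    bs%n≡ρ : b * s % n ≡ ρ
    bs%n≡ρ = trans (%-≡-+* _ _ 0 K (trans (+-identityʳ _) bs≡ρ+Kn)) (m<n⇒m%n≡m ρ<n)
    s+1≤n∸ρ+b : s + 1 ≤ n ∸ ρ + b
    s+1≤n∸ρ+b = subst (s + 1 ≤_) (+-∸-comm b (<⇒≤ ρ<n))
      (m+n≤o⇒m≤o∸n (s + 1) (subst (_≤ n + b) (shuffle ρ s) ρ+s+1≤n+b))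
      where
      shuffle : ∀ ρ s → ρ + s + 1 ≡ s + 1 + ρ
      shuffle = solve-∀

  module _ (q r : ℕ) (n≡qs+r : n ≡ q * s + r) (r<s : r < s) (2s<n : 2 * s < n) where

    private
      s<n : s < n
      s<n = ≤-<-trans (m≤m+n s (s + 0)) 2s<n

      0<q : 0 < q
      0<q = n≢0⇒n>0 (λ q≡0 → <-irrefl refl (subst (r <_) (trans n≡qs+r (cong (λ x → x * s + r) q≡0)) r<n))
        where r<n = <-trans r<s s<n

      cs+s≤n : ∀ c → c < q → c * s + s ≤ n
      cs+s≤n c c<q = begin
        c * s + s     ≡⟨ +-comm (c * s) s ⟩
        suc c * s     ≤⟨ *-monoˡ-≤ s c<q ⟩
        q * s         ≤⟨ m≤m+n (q * s) r ⟩
        q * s + r     ≡⟨ n≡qs+r ⟨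
        n             ∎
        where open ≤-Reasoning

    -- Write b = c + p q with c < q; as q s = n − r, b s ≡ c s − p r.
    dichotomy-r≤q : r ≤ q → ∀ b → 0 < b → b ≤ s → Dichotomy b
    dichotomy-r≤q r≤q b 0<b b≤s = split (b % q) (b / q) (m≡m%n+[m/n]*n b q) (m%n<n b q)
      where
      instance q-nonZero = >-nonZero 0<q
      split : ∀ c p → b ≡ c + p * q → c < q → Dichotomy b
      split zero    p b≡pq    c<q = near-neg p (begin-equality
        b * s + p * r          ≡⟨ cong (λ m → m * s + p * r) b≡pq ⟩
        p * q * s + p * r      ≡⟨ factor p q s r ⟩
        p * (q * s + r)        ≡⟨ cong (p *_) n≡qs+r ⟨
        p * n                  ∎) (subst (p * r ≤_) (sym b≡pq) (*-monoʳ-≤ p r≤q))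
        where
        open ≤-Reasoning
        factor : ∀ p q s r → p * q * s + p * r ≡ p * (q * s + r)
        factor = solve-∀
      split (suc c) p b≡c+pq c<q = far p b≤s bs≡ρ+pn s+1≤ρ+b ρ+s+1≤n+b
        where
        pr≤pq : p * r ≤ p * q
        pr≤pq = *-monoʳ-≤ p r≤q
        pq≤b : p * q ≤ b
        pq≤b = subst (p * q ≤_) (sym b≡c+pq) (m≤n+m (p * q) (suc c))
        pr≤[1+c]s : p * r ≤ suc c * s
        pr≤[1+c]s = ≤-trans pr≤pq (≤-trans pq≤b (≤-trans b≤s (m≤m+n s (c * s))))
        ρ = suc c * s ∸ p * r
        ρ+pr≡[1+c]s : ρ + p * r ≡ suc c * s
        ρ+pr≡[1+c]s = m∸n+n≡m pr≤[1+c]s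
        bs≡ρ+pn : b * s ≡ ρ + p * n
        bs≡ρ+pn = begin-equality
          b * s                        ≡⟨ cong (_* s) b≡c+pq ⟩
          (suc c + p * q) * s          ≡⟨ *-distribʳ-+ s (suc c) (p * q) ⟩
          suc c * s + p * q * s        ≡⟨ cong (_+ p * q * s) ρ+pr≡[1+c]s ⟨
          ρ + p * r + p * q * s        ≡⟨ regroup ρ p r q s ⟩
          ρ + p * (q * s + r)          ≡⟨ cong (λ m → ρ + p * m) n≡qs+r ⟨
          ρ + p * n                    ∎
          where
          open ≤-Reasoning
          regroup : ∀ ρ p r q s → ρ + p * r + p * q * s ≡ ρ + p * (q * s + r)
          regroup = solve-∀
        s+1≤ρ+b : s + 1 ≤ ρ + b
        s+1≤ρ+b = begin
          s + 1                  ≤⟨ +-monoˡ-≤ 1 (m≤m+n s (c * s)) ⟩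
          suc c * s + 1          ≡⟨ cong (_+ 1) ρ+pr≡[1+c]s ⟨
          ρ + p * r + 1          ≤⟨ +-mono-≤ (+-monoʳ-≤ ρ pr≤pq) (s≤s z≤n) ⟩
          ρ + p * q + suc c      ≡⟨ trans (+-assoc ρ _ _) (cong (ρ +_) (trans (+-comm (p * q) (suc c)) (sym b≡c+pq))) ⟩
          ρ + b                  ∎
          where open ≤-Reasoning
        ρ+s+1≤n+b : ρ + s + 1 ≤ n + b
        ρ+s+1≤n+b = +-mono-≤ (≤-trans (+-monoˡ-≤ s (m∸n≤m (suc c * s) (p * r))) (cs+s≤n (suc c) c<q)) 0<b

    -- Write b = c + p (q + 1) with c ≤ q; as (q + 1) s = n + (s − r), b s ≡ c s + p (s − r).
    dichotomy-s<r+q : s < r + q → ∀ b → 0 < b → b ≤ s → Dichotomy b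
    dichotomy-s<r+q s<r+q b 0<b b≤s = split (b % suc q) (b / suc q) (m≡m%n+[m/n]*n b (suc q)) (m%n<n b (suc q))
      where
      e = s ∸ r
      r+e≡s : r + e ≡ s
      r+e≡s = m+[n∸m]≡n (<⇒≤ r<s)
      e<q : e < q
      e<q = +-cancelˡ-≤ r _ _ (subst (_≤ r + q) (trans (cong suc (sym r+e≡s)) (sym (+-suc r e))) s<r+q)
      [1+q]s≡n+e : suc q * s ≡ n + e
      [1+q]s≡n+e = begin-equality
        s + q * s         ≡⟨ cong (_+ q * s) r+e≡s ⟨
        r + e + q * s     ≡⟨ shuffle r e (q * s) ⟩
        q * s + r + e     ≡⟨ cong (_+ e) n≡qs+r ⟨
        n + e             ∎
        where
        open ≤-Reasoning
        shuffle : ∀ a b c → a + b + c ≡ c + a + b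
        shuffle = solve-∀
      bs≡cs+pe+pn : ∀ c p → b ≡ c + p * suc q → b * s ≡ c * s + p * e + p * n
      bs≡cs+pe+pn c p b≡c+p[1+q] = begin-equality
        b * s                       ≡⟨ cong (_* s) b≡c+p[1+q] ⟩
        (c + p * suc q) * s         ≡⟨ shuffle c p (suc q) s ⟩
        c * s + p * (suc q * s)     ≡⟨ cong (λ m → c * s + p * m) [1+q]s≡n+e ⟩
        c * s + p * (n + e)         ≡⟨ shuffle′ c p n e s ⟩
        c * s + p * e + p * n       ∎
        where
        open ≤-Reasoning
        shuffle : ∀ c p q s → (c + p * q) * s ≡ c * s + p * (q * s)
        shuffle = solve-∀
        shuffle′ : ∀ c p n e s → c * s + p * (n + e) ≡ c * s + p * e + p * n
        shuffle′ = solve-∀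
      split : ∀ c p → b ≡ c + p * suc q → c < suc q → Dichotomy b
      split zero p b≡p[1+q] _ = near p (bs≡cs+pe+pn 0 p b≡p[1+q])
        (subst (p * e ≤_) (sym b≡p[1+q]) (*-monoʳ-≤ p (≤-trans (n≤1+n e) (<⇒≤ (s≤s e<q)))))
      split (suc c) p b≡c+p[1+q] c<1+q with suc c <? q
      ... | yes c<q = far p b≤s (bs≡cs+pe+pn (suc c) p b≡c+p[1+q])
        (+-mono-≤ (≤-trans (m≤m+n s (c * s)) (m≤m+n _ (p * e))) 0<b)
        (subst (_≤ n + b) (shuffle (suc c * s) (p * e) s) (+-mono-≤ (cs+s≤n (suc c) c<q) pe+1≤b))
        where
        pe+1≤b : p * e + 1 ≤ b
        pe+1≤b = subst (p * e + 1 ≤_) (trans (+-comm _ (suc c)) (sym b≡c+p[1+q]))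
          (+-mono-≤ (*-monoʳ-≤ p (≤-trans (n≤1+n e) (<⇒≤ (s≤s e<q)))) (s≤s z≤n))
        shuffle : ∀ a b s → a + s + (b + 1) ≡ a + b + s + 1
        shuffle = solve-∀
      ... | no  c≮q = top-quotient (≤-antisym (≤-pred c<1+q) (≮⇒≥ c≮q))
        where
        pe≤p[1+q] : p * e ≤ p * suc q
        pe≤p[1+q] = *-monoʳ-≤ p (≤-trans (n≤1+n e) (<⇒≤ (s≤s e<q)))
        top-quotient : suc c ≡ q → Dichotomy b
        top-quotient c≡q with r ≤? p * e
        ... | yes r≤pe = near (suc p) (begin-equality
          b * s                                ≡⟨ bs≡cs+pe+pn (suc c) p b≡c+p[1+q] ⟩
          suc c * s + p * e + p * n            ≡⟨ cong (λ m → m * s + p * e + p * n) c≡q ⟩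
          q * s + p * e + p * n                ≡⟨ cong (λ m → q * s + m + p * n) (m∸n+n≡m r≤pe) ⟨
          q * s + (p * e ∸ r + r) + p * n      ≡⟨ shuffle (q * s) (p * e ∸ r) r (p * n) ⟩
          p * e ∸ r + (q * s + r) + p * n      ≡⟨ cong (λ m → p * e ∸ r + m + p * n) n≡qs+r ⟨
          p * e ∸ r + n + p * n                ≡⟨ +-assoc (p * e ∸ r) n (p * n) ⟩
          p * e ∸ r + suc p * n                ∎)
          (≤-trans (m∸n≤m (p * e) r) (≤-trans pe≤p[1+q] (subst (p * suc q ≤_) (sym b≡c+p[1+q]) (m≤n+m _ (suc c)))))
          where
          open ≤-Reasoning
          shuffle : ∀ a t r k → a + (t + r) + k ≡ t + (a + r) + k
          shuffle = solve-∀
        ... | no  r≰pe = far p b≤s bs≡qs+pe+pn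
          (+-mono-≤ (≤-trans (subst (λ m → s ≤ m * s) c≡q (m≤m+n s (c * s))) (m≤m+n (q * s) (p * e))) 0<b)
          (begin
            q * s + p * e + s + 1                ≡⟨ cong (λ m → q * s + p * e + m + 1) r+e≡s ⟨
            q * s + p * e + (r + e) + 1          ≡⟨ shuffle (q * s) (p * e) r e ⟩
            (q * s + r) + (p * e + e + 1)        ≡⟨ cong (_+ (p * e + e + 1)) n≡qs+r ⟨
            n + (p * e + e + 1)                  ≤⟨ +-monoʳ-≤ n pe+e+1≤b ⟩
            n + b                                ∎)
          where
          open ≤-Reasoning
          bs≡qs+pe+pn : b * s ≡ q * s + p * e + p * n
          bs≡qs+pe+pn = trans (bs≡cs+pe+pn (suc c) p b≡c+p[1+q]) (cong (λ m → m * s + p * e + p * n) c≡q)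
          shuffle : ∀ a b r e → a + b + (r + e) + 1 ≡ (a + r) + (b + e + 1)
          shuffle = solve-∀
          pe+e+1≤b : p * e + e + 1 ≤ b
          pe+e+1≤b = begin
            p * e + e + 1        ≡⟨ +-assoc (p * e) e 1 ⟩
            p * e + (e + 1)      ≤⟨ +-mono-≤ pe≤p[1+q] (subst (_≤ q) (+-comm 1 e) e<q) ⟩
            p * suc q + q        ≡⟨ +-comm _ q ⟩
            q + p * suc q        ≡⟨ cong (_+ p * suc q) c≡q ⟨
            suc c + p * suc q    ≡⟨ b≡c+p[1+q] ⟨
            b                    ∎

    dichotomy : r ≤ q ⊎ s < r + q → ∀ b → b ≤ s → Dichotomy b
    dichotomy _                zero    _   = near 0 refl z≤n
    dichotomy (inj₁ r≤q)       (suc b) b≤s = dichotomy-r≤q r≤q (suc b) (s≤s z≤n) b≤s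
    dichotomy (inj₂ s<r+q)     (suc b) b≤s = dichotomy-s<r+q s<r+q (suc b) (s≤s z≤n) b≤s

-- Lower bound for the potential

tentSum : ℕ → ℕ
tentSum k = ∑ℕ[ i < k ] (suc i ⊓ (k ∸ i))

private
  ∑ℕ-suc : ∀ k (f : ℕ → ℕ) → ∑ℕ[ i < k ] suc (f i) ≡ k + ∑ℕ[ i < k ] f i
  ∑ℕ-suc zero    f = refl
  ∑ℕ-suc (suc k) f = cong suc (trans (cong (f 0 +_) (∑ℕ-suc k (f ∘ suc))) (+-comm-left (f 0) k _))
    where
    +-comm-left : ∀ a b c → a + (b + c) ≡ b + (a + c)
    +-comm-left = solve-∀

tentSum-+2 : ∀ k → tentSum (suc (suc k)) ≡ suc (k + tentSum k + 1)
tentSum-+2 k = cong suc (begin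
  ∑ℕ[ i < suc k ] f (suc i)                      ≡⟨ ∑ℕ-init-last k (f ∘ suc) ⟩
  ∑ℕ[ i < k ] f (suc i) + f (suc k)
    ≡⟨ cong₂ _+_ (∑ℕ-cong k (λ i i<k → cong (suc (suc i) ⊓_) (+-∸-assoc 1 (<⇒≤ i<k)))) f[1+k]≡1 ⟩
  ∑ℕ[ i < k ] suc (suc i ⊓ (k ∸ i)) + 1          ≡⟨ cong (_+ 1) (∑ℕ-suc k (λ i → suc i ⊓ (k ∸ i))) ⟩
  k + tentSum k + 1                              ∎)
  where
  open ≡-Reasoning
  f : ℕ → ℕ
  f i = suc i ⊓ (suc (suc k) ∸ i)
  f[1+k]≡1 : f (suc k) ≡ 1
  f[1+k]≡1 = cong (suc (suc k) ⊓_) (m+n∸n≡m 1 k)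

square≤4*tentSum+1 : ∀ k → (k + 1) * (k + 1) ≤ 4 * tentSum k + 1
square≤4*tentSum+1 zero          = ≤-refl
square≤4*tentSum+1 (suc zero)    = s≤s (s≤s (s≤s (s≤s z≤n)))
square≤4*tentSum+1 (suc (suc k)) = begin
  (suc (suc k) + 1) * (suc (suc k) + 1) ≡⟨ expand k ⟩
  (k + 1) * (k + 1) + (4 * k + 8)     ≤⟨ +-monoˡ-≤ _ (square≤4*tentSum+1 k) ⟩
  4 * tentSum k + 1 + (4 * k + 8)     ≡⟨ collect k (tentSum k) ⟩
  4 * suc (k + tentSum k + 1) + 1     ≡⟨ cong (λ m → 4 * m + 1) (tentSum-+2 k) ⟨
  4 * tentSum (suc (suc k)) + 1       ∎
  where
  open ≤-Reasoning
  expand : ∀ k → (suc (suc k) + 1) * (suc (suc k) + 1) ≡ (k + 1) * (k + 1) + (4 * k + 8)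
  expand = solve-∀
  collect : ∀ k t → 4 * t + 1 + (4 * k + 8) ≡ 4 * suc (k + t + 1) + 1
  collect = solve-∀

⌊square/2⌋≤2*tentSum : ∀ k → (k + 1) * (k + 1) / 2 ≤ 2 * tentSum k
⌊square/2⌋≤2*tentSum k = ≤-trans (/-monoˡ-≤ 2 (square≤4*tentSum+1 k)) (≤-reflexive [4t+1]/2≡2t)
  where
  t = tentSum k
  [4t+1]/2≡2t : (4 * t + 1) / 2 ≡ 2 * t
  [4t+1]/2≡2t = trans (cong (_/ 2) (shuffle t))
    (trans (+-distrib-/ 1 (2 * t * 2) {2} (subst (λ m → 1 + m < 2) (sym (m*n%n≡0 (2 * t) 2)) ≤-refl))
           (m*n/n≡m (2 * t) 2))
    where
    shuffle : ∀ t → 4 * t + 1 ≡ 1 + 2 * t * 2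
    shuffle = solve-∀

module TentBound (n s : ℕ) .{{_ : NonZero n}} (2s<n : 2 * s < n) where

  open CircularNorm n

  tent : ℕ → ℕ
  tent v = v ⊓ (suc s ∸ v)

  -- Reverse triangle inequality: ‖ v + c ‖ ≥ v − ‖ c ‖ and ‖ v + c ‖ ≥ ‖ c ‖ − v.
  tent≤cost : ∀ {v} c b → v ≤ s → ‖ c ‖ ≤ b ⊎ s + 1 ≤ ‖ c ‖ + b → tent v ≤ b + ‖ v + c ‖
  tent≤cost {v} c b v≤s (inj₁ ‖c‖≤b) = begin
    tent v                 ≤⟨ m⊓n≤m v _ ⟩
    v                      ≤⟨ ‖‖-lower v<n ≤-refl v+v≤n ⟩
    ‖ v ‖                  ≤⟨ ‖‖-reverse-triangle v c ⟩
    ‖ v + c ‖ + ‖ c ‖      ≤⟨ +-monoʳ-≤ ‖ v + c ‖ ‖c‖≤b ⟩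
    ‖ v + c ‖ + b          ≡⟨ +-comm _ b ⟩
    b + ‖ v + c ‖          ∎
    where
    open ≤-Reasoning
    v+v≤n : v + v ≤ n
    v+v≤n = ≤-trans (+-mono-≤ v≤s (≤-trans v≤s (≤-reflexive (sym (+-identityʳ s))))) (<⇒≤ 2s<n)
    v<n : v < n
    v<n = ≤-<-trans v≤s (≤-<-trans (m≤m+n s (s + 0)) 2s<n)
  tent≤cost {v} c b v≤s (inj₂ s+1≤‖c‖+b) = ≤-trans (m⊓n≤n v _) (m≤n+o⇒m∸n≤o (suc s) v (begin
    suc s                          ≡⟨ +-comm 1 s ⟩
    s + 1                          ≤⟨ s+1≤‖c‖+b ⟩
    ‖ c ‖ + b                      ≤⟨ +-monoˡ-≤ b (‖‖-reverse-triangle c v) ⟩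
    ‖ c + v ‖ + ‖ v ‖ + b          ≤⟨ +-monoˡ-≤ b (+-monoʳ-≤ ‖ c + v ‖ ‖v‖≤v) ⟩
    ‖ c + v ‖ + v + b              ≡⟨ shuffle ‖ c + v ‖ v b ⟩
    v + (b + ‖ c + v ‖)            ≡⟨ cong (λ m → v + (b + ‖ m ‖)) (+-comm c v) ⟩
    v + (b + ‖ v + c ‖)            ∎))
    where
    open ≤-Reasoning
    shuffle : ∀ a v b → a + v + b ≡ v + (b + a)
    shuffle = solve-∀
    ‖v‖≤v : ‖ v ‖ ≤ v
    ‖v‖≤v = ≤-trans (‖‖≤% v) (m%n≤m v n)

  module _ (dichotomy : ∀ b → b ≤ s → MultiplesOfStep.Dichotomy n s b) where

    private
      s≤n : s ≤ n
      s≤n = ≤-trans (m≤m+n s (s + 0)) (<⇒≤ 2s<n)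

    open Potential n s using (Ψ-glb)
    open CirculantPotential n s s≤n

    tent≤Φ : ∀ {v} → v ≤ s → tent v ≤ Φ v
    tent≤Φ {v} v≤s = Ψ-glb (n ∸ s) s v (≤-trans (m⊓n≤m v _) v≤s) (λ b b<s →
        tent≤cost (b * (n ∸ s)) b v≤s (subst (λ m → m ≤ b ⊎ s + 1 ≤ m + b) (‖bs‖≡‖b[n∸s]‖ {b}) (dichotomy b (<⇒≤ b<s))) ,
        tent≤cost (b * s) b v≤s (dichotomy b (<⇒≤ b<s)))
      where
      ‖bs‖≡‖b[n∸s]‖ : ∀ {b} → ‖ b * s ‖ ≡ ‖ b * (n ∸ s) ‖
      ‖bs‖≡‖b[n∸s]‖ {b} = ‖‖-neg (b * s) (b * (n ∸ s)) b
        (trans (sym (*-distribˡ-+ b s (n ∸ s))) (cong (b *_) (m+[n∸m]≡n s≤n)))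

    tent≤Φ-neg : ∀ {z u} → z + u ≡ n → u ≤ s → tent u ≤ Φ z
    tent≤Φ-neg {z} {u} z+u≡n u≤s = subst (tent u ≤_) (Φ-neg 1 u+z≡1n) (tent≤Φ u≤s)
      where u+z≡1n = trans (+-comm u z) (trans z+u≡n (sym (*-identityˡ n)))

    tent-sym : ∀ {i} → i < s → tent (s ∸ i) ≡ tent (suc i)
    tent-sym {i} i<s = trans (cong ((s ∸ i) ⊓_) 1+s∸[s∸i]≡1+i) (⊓-comm (s ∸ i) (suc i))
      where
      1+s∸[s∸i]≡1+i : suc s ∸ (s ∸ i) ≡ suc i
      1+s∸[s∸i]≡1+i = trans (+-∸-assoc 1 (m∸n≤m s i)) (cong suc (m∸[m∸n]≡n (<⇒≤ i<s)))

    -- The residues 1, …, s and n − s, …, n − 1 each contribute tentSum s.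
    ∑Φ-lower : tentSum s + tentSum s ≤ ∑ℕ[ z < n ] Φ z
    ∑Φ-lower = begin
      tentSum s + tentSum s
        ≤⟨ +-mono-≤ first-block last-block ⟩
      ∑ℕ[ z < suc s ] Φ z + ∑ℕ[ i < s ] Φ (suc s + (gap + i))
        ≤⟨ +-monoʳ-≤ (∑ℕ[ z < suc s ] Φ z) (m≤n+m _ _) ⟩
      ∑ℕ[ z < suc s ] Φ z + (∑ℕ[ i < gap ] Φ (suc s + i) + ∑ℕ[ i < s ] Φ (suc s + (gap + i)))
        ≡⟨ cong (∑ℕ[ z < suc s ] Φ z +_) (∑ℕ-+ gap s (λ i → Φ (suc s + i))) ⟨
      ∑ℕ[ z < suc s ] Φ z + ∑ℕ[ i < gap + s ] Φ (suc s + i)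
        ≡⟨ ∑ℕ-+ (suc s) (gap + s) Φ ⟨
      ∑ℕ[ z < suc s + (gap + s) ] Φ z
        ≡⟨ cong (λ m → ∑ℕ[ z < m ] Φ z) n≡1+s+[gap+s] ⟨
      ∑ℕ[ z < n ] Φ z ∎
      where
      open ≤-Reasoning
      gap = n ∸ suc (s + s)
      n≡1+s+[gap+s] : n ≡ suc s + (gap + s)
      n≡1+s+[gap+s] = begin-equality
        n                          ≡⟨ m+[n∸m]≡n 1+2s≤n ⟨
        suc (s + s) + gap          ≡⟨ shuffle s gap ⟩
        suc s + (gap + s)          ∎
        where
        1+2s≤n : suc (s + s) ≤ n
        1+2s≤n = subst (λ m → suc (s + m) ≤ n) (+-identityʳ s) 2s<n
        shuffle : ∀ s g → suc (s + s) + g ≡ suc s + (g + s)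
        shuffle = solve-∀
      z+u≡n : ∀ {i} → i < s → suc s + (gap + i) + (s ∸ i) ≡ n
      z+u≡n {i} i<s = begin-equality
        suc s + (gap + i) + (s ∸ i)     ≡⟨ +-assoc (suc s) _ _ ⟩
        suc s + (gap + i + (s ∸ i))     ≡⟨ cong (λ m → suc s + m) (+-assoc gap i _) ⟩
        suc s + (gap + (i + (s ∸ i)))   ≡⟨ cong (λ m → suc s + (gap + m)) (m+[n∸m]≡n (<⇒≤ i<s)) ⟩
        suc s + (gap + s)               ≡⟨ n≡1+s+[gap+s] ⟨
        n                               ∎
      first-block : tentSum s ≤ ∑ℕ[ z < suc s ] Φ z
      first-block = ≤-trans (∑ℕ-mono-≤ s (λ i i<s → tent≤Φ i<s)) (m≤n+m _ (Φ 0))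
      last-block : tentSum s ≤ ∑ℕ[ i < s ] Φ (suc s + (gap + i))
      last-block = ∑ℕ-mono-≤ s (λ i i<s →
        subst (_≤ Φ (suc s + (gap + i))) (tent-sym i<s) (tent≤Φ-neg (z+u≡n i<s) (m∸n≤m s i)))

theorem1p3 : (n s q r : ℕ) → 5 ≤ n → 1 < s → 2 * s < n →
    n ≡ q * s + r → r < s →
    (r ≤ q ⊎ s + 1 ≤ r + q) →
    (R : Routing n) → IsAllToAllRouting n s R →
    ((s + 1) * (s + 1)) / 2 ≤ 2 * maxLoad n s R
theorem1p3 n s q r _ 1<s 2s<n n≡qs+r r<s r≤q⊎s<r+q R all-to-all = begin
  (s + 1) * (s + 1) / 2                ≤⟨ ⌊square/2⌋≤2*tentSum s ⟩
  2 * tentSum s                        ≡⟨ cong (tentSum s +_) (+-identityʳ (tentSum s)) ⟩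
  tentSum s + tentSum s                ≤⟨ TentBound.∑Φ-lower n s 2s<n dichotomy ⟩
  ∑ℕ[ z < n ] Φ z                      ≤⟨ RoutingBound.∑Φ≤2*maxLoad n s (<-trans (s≤s z≤n) 1<s) s<n R all-to-all ⟩
  2 * maxLoad n s R                    ∎
  where
  open ≤-Reasoning
  instance n-nonZero = >-nonZero (≤-<-trans z≤n 2s<n)
  s<n = ≤-<-trans (m≤m+n s (s + 0)) 2s<n
  open CirculantPotential n s (<⇒≤ s<n) using (Φ)
  dichotomy = MultiplesOfStep.dichotomy n s q r n≡qs+r r<s 2s<n (⊎-map id (subst (_≤ r + q) (+-comm s 1)) r≤q⊎s<r+q)
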